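{- Let $\sigma_1, \sigma_2, \ldots, \sigma_r$ be distinct permutations in $S_3$. Then $S_n(\sigma_1, \sigma_2, \ldots, \sigma_r)$ is sign-balanced for every integer $n>1$ if and only if $\{\sigma_1, \sigma_2, \ldots, \sigma_r\}\neq\{132, 213, 231, 312\}$ and the set $\{\sigma_1, \sigma_2, \ldots, \sigma_r\}$ is sign-balanced.
   Context: Permutations are written in one-line notation $\pi=\pi_1\pi_2\cdots\pi_n\in S_n$. For $\sigma\in S_k$ and $\pi\in S_n$ with $k\le n$, $\pi$ contains the pattern $\sigma$ if there are indices $1\le i_1<\cdots<i_k\le n$ such that for all $1\le s<t\le k$, $\pi_{i_s}>\pi_{i_t}$ iff $\sigma_s>\sigma_t$; otherwise $\pi$ avoids $\sigma$. $S_n(\sigma_1,\ldots,\sigma_r)$ denotes the set of permutations in $S_n$ avoiding every $\sigma_j$. An inversion of $\pi$ is a pair $i<j$ with $\pi_i>\pi_j$; $\pi$ is even (odd) if its number of inversions is even (odd). A set of permutations is sign-balanced if it contains the same number of even permutations as odd permutations. -}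

module Defs where

open import Data.Bool using (Bool; true; false; not; _∧_; _xor_; if_then_else_)
open import Data.Nat using (ℕ; zero; suc; _+_; _<ᵇ_; _≡ᵇ_; _%_)
open import Data.List using (List; []; _∷_; _++_; map; concatMap; upTo; zipWith)
open import Data.Bool.ListAction using (and; any; all)

-- Permutations of S_n are represented in one-line notation as lists of
-- natural numbers π₁ π₂ ⋯ πₙ with entries in {1,…,n}; e.g. 132 is 1 ∷ 3 ∷ 2 ∷ [].

count : {A : Set} → (A → Bool) → List A → ℕ
count p []       = 0
count p (x ∷ xs) = (if p x then 1 else 0) + count p xs

allLists : ℕ → ℕ → List (List ℕ)
allLists zero    m = [] ∷ []
allLists (suc k) m = concatMap (λ x → map (x ∷_) (allLists k m)) (map suc (upTo m))

distinct : List ℕ → Bool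
distinct []       = true
distinct (x ∷ xs) = not (any (x ≡ᵇ_) xs) ∧ distinct xs

S : ℕ → List (List ℕ)
S n = go (allLists n n)
  where
  go : List (List ℕ) → List (List ℕ)
  go []       = []
  go (l ∷ ls) = if distinct l then l ∷ go ls else go ls

inv : List ℕ → ℕ
inv []       = 0
inv (x ∷ xs) = count (λ y → y <ᵇ x) xs + inv xs

isEven : List ℕ → Bool
isEven π = inv π % 2 ≡ᵇ 0

isOdd : List ℕ → Bool
isOdd π = not (isEven π)

SignBalanced : List (List ℕ) → Set
SignBalanced L = count isEven L ≡ count isOdd L
  where open import Relation.Binary.PropositionalEquality using (_≡_)

choose : ℕ → List ℕ → List (List ℕ)
choose zero    _        = [] ∷ []
choose (suc k) []       = []
choose (suc k) (x ∷ xs) = map (x ∷_) (choose k xs) ++ choose (suc k) xs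

_==_ : Bool → Bool → Bool
a == b = not (a xor b)

sameOrder : List ℕ → List ℕ → Bool
sameOrder []       []       = true
sameOrder (x ∷ xs) (y ∷ ys) =
  and (zipWith (λ a b → (a <ᵇ x) == (b <ᵇ y)) xs ys) ∧ sameOrder xs ys
sameOrder _        _        = false

length' : List ℕ → ℕ
length' []       = 0
length' (_ ∷ xs) = suc (length' xs)

contains : List ℕ → List ℕ → Bool
contains π σ = any (λ s → sameOrder s σ) (choose (length' σ) π)

avoidsAll : List (List ℕ) → List ℕ → Bool
avoidsAll pats π = all (λ σ → not (contains π σ)) pats

Av : ℕ → List (List ℕ) → List (List ℕ)
Av n pats = go (S n)
  where
  go : List (List ℕ) → List (List ℕ)
  go []       = []
  go (l ∷ ls) = if avoidsAll pats l then l ∷ go ls else go ls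

special : List (List ℕ)
special = (1 ∷ 3 ∷ 2 ∷ []) ∷ (2 ∷ 1 ∷ 3 ∷ []) ∷ (2 ∷ 3 ∷ 1 ∷ []) ∷ (3 ∷ 1 ∷ 2 ∷ []) ∷ []

-- A set of patterns of length 3 is a predicate B on the six patterns. An involution of
-- S_n that changes the number of inversions by exactly one and maps S_n(B) to itself shows
-- that S_n(B) is sign-balanced. Exchanging the first two (last two) entries of a permutation
-- is such an involution when B is invariant under exchanging the first two (last two)
-- positions of a pattern; exchanging the values 1, 2 (resp. n - 1, n) is one when B is
-- invariant under exchanging the two smallest (two largest) values. If B contains both 123
-- and 321 then S_n(B) is empty for n ≥ 5 by the Erdős–Szekeres theorem. Each of the 64
-- pattern sets satisfying the criterion falls under one of these cases, after checking
-- n ≤ 4 in the last one, and every other set is already unbalanced for n = 3 or n = 4.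

module Submission where

open import Defs
open import Data.Bool using (Bool; true; false; not; _∧_; _∨_; _xor_; if_then_else_)
open import Data.Bool.Properties
  using ( ∧-commutativeMonoid; ∧-distribʳ-∨; ∧-assoc; ∧-identityʳ; ∧-comm; ∨-comm; ∧-conicalˡ
        ; ∧-conicalʳ; ∧-zeroʳ; ∨-identityʳ; not-involutive; not-injective; T-≡)
open import Data.Bool.ListAction using (any; all)
open import Data.Empty using (⊥; ⊥-elim)
open import Data.List using (List; []; _∷_; _++_; map; concatMap; upTo; applyUpTo; length; filterᵇ)
open import Data.List.Properties
  using (≡-dec; map-++; map-∘; length-map; length-++; length-upTo; upTo-∷ʳ; ++-assoc; ++-identityʳ)
open import Data.List.Membership.Propositional using (_∈_; find)
open import Data.List.Membership.Propositional.Properties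
  using ( ∈-++⁻; ∈-++⁺ˡ; ∈-++⁺ʳ; ∈-map⁻; ∈-map⁺; ∈-∃++; ∈-upTo⁺; ∈-upTo⁻; ∈-applyUpTo⁻
        ; ∈-concatMap⁻)
open import Data.List.Relation.Binary.Sublist.Propositional using (_⊆_; []; _∷_; _∷ʳ_; minimum; lookup; ⊆-trans)
open import Data.List.Relation.Unary.All using (All; _∷_)
import Data.List.Relation.Unary.All as All
open import Data.List.Relation.Unary.Any using (here; there)
open import Data.List.Relation.Unary.Unique.Propositional using (Unique)
open import Data.List.Relation.Unary.AllPairs using (_∷_)
open import Data.Maybe using (Maybe; just; nothing; maybe′)
import Data.Maybe as Maybe
open import Data.Nat using (ℕ; zero; suc; _+_; _<_; _≤_; z≤n; s≤s; _<ᵇ_; _≡ᵇ_; _%_)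
open import Data.Nat.Properties
  using ( _≟_; +-assoc; +-comm; +-suc; +-identityʳ; +-commutativeSemigroup; ≤-refl; ≤-trans; ≤-pred
        ; ≤∧≢⇒<; <-trans; <⇒≤; <-irrefl; ≤-<-trans; <-≤-trans; n<1+n; n≤1+n; 1+n≢n; suc-injective
        ; <-cmp; ≡ᵇ⇒≡; ≡⇒≡ᵇ; <ᵇ⇒<; <⇒<ᵇ)
import Algebra.Properties.CommutativeSemigroup as CommSemigroupProperties
open import Algebra.Bundles using (CommutativeMonoid)
open CommSemigroupProperties +-commutativeSemigroup
  using () renaming (interchange to +-interchange; x∙yz≈y∙xz to +-exchange)
open CommSemigroupProperties (CommutativeMonoid.commutativeSemigroup ∧-commutativeMonoid)
  using () renaming (interchange to ∧-interchange)
open import Data.List.Membership.DecPropositional _≟_ using (_∈?_)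
open import Data.List.Membership.DecPropositional (≡-dec _≟_) using () renaming (_∈?_ to _∈ᴸ?_)
open import Data.Nat.DivMod using ([m+n]%n≡m%n)
open import Data.Product using (∃; _×_; _,_; proj₁; proj₂)
open import Data.Sum using (_⊎_; inj₁; inj₂)
open import Function.Bundles using (_⇔_; mk⇔; Equivalence)
open import Function.Construct.Composition using (_⇔-∘_)
open import Function.Construct.Symmetry using (⇔-sym)
open import Relation.Binary.Definitions using (tri<; tri≈; tri>)
open import Relation.Binary.PropositionalEquality
  using (_≡_; _≢_; refl; sym; trans; cong; cong₂; subst; module ≡-Reasoning)
open import Relation.Nullary using (¬_; Dec; yes; no; does)
open import Relation.Nullary.Decidable using (dec-true)

bool-ext : ∀ {a b : Bool} → (a ≡ true → b ≡ true) → (b ≡ true → a ≡ true) → a ≡ b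
bool-ext {true}  {true}  _ _ = refl
bool-ext {true}  {false} f _ = sym (f refl)
bool-ext {false} {true}  _ g = g refl
bool-ext {false} {false} _ _ = refl

false≢true : false ≢ true
false≢true ()

∧-true⁻ : ∀ {a b} → a ∧ b ≡ true → a ≡ true × b ≡ true
∧-true⁻ {true} e = refl , e

∨-true⁻ : ∀ {a b} → a ∨ b ≡ true → a ≡ true ⊎ b ≡ true
∨-true⁻ {true}  _ = inj₁ refl
∨-true⁻ {false} e = inj₂ e

∨-trueʳ : ∀ a {b} → b ≡ true → a ∨ b ≡ true
∨-trueʳ true  _ = refl
∨-trueʳ false e = e

==-sound : ∀ {a b} → (a == b) ≡ true → a ≡ b
==-sound {true}  {true}  _ = refl
==-sound {false} {false} _ = refl

==-refl : ∀ a → (a == a) ≡ true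
==-refl true  = refl
==-refl false = refl

==-complete : ∀ {a b} → a ≡ b → (a == b) ≡ true
==-complete {a} refl = ==-refl a

≡⇒≡ᵇ-true : ∀ {m n} → m ≡ n → (m ≡ᵇ n) ≡ true
≡⇒≡ᵇ-true {m} {n} m≡n = Equivalence.to T-≡ (≡⇒≡ᵇ m n m≡n)

≡ᵇ-refl : ∀ n → (n ≡ᵇ n) ≡ true
≡ᵇ-refl n = ≡⇒≡ᵇ-true {n} refl

≡ᵇ-sound : ∀ m n → (m ≡ᵇ n) ≡ true → m ≡ n
≡ᵇ-sound m n e = ≡ᵇ⇒≡ m n (Equivalence.from T-≡ e)

≡ᵇ-sym : ∀ m n → (m ≡ᵇ n) ≡ (n ≡ᵇ m)
≡ᵇ-sym zero    zero    = refl
≡ᵇ-sym zero    (suc n) = refl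
≡ᵇ-sym (suc m) zero    = refl
≡ᵇ-sym (suc m) (suc n) = ≡ᵇ-sym m n

≢⇒≡ᵇ-false : ∀ m n → m ≢ n → (m ≡ᵇ n) ≡ false
≢⇒≡ᵇ-false zero    zero    ne = ⊥-elim (ne refl)
≢⇒≡ᵇ-false zero    (suc n) ne = refl
≢⇒≡ᵇ-false (suc m) zero    ne = refl
≢⇒≡ᵇ-false (suc m) (suc n) ne = ≢⇒≡ᵇ-false m n (λ e → ne (cong suc e))

<⇒<ᵇ-true : ∀ {m n} → m < n → (m <ᵇ n) ≡ true
<⇒<ᵇ-true m<n = Equivalence.to T-≡ (<⇒<ᵇ m<n)

≤⇒<ᵇ-false : ∀ {m n} → n ≤ m → (m <ᵇ n) ≡ false
≤⇒<ᵇ-false {m}     {zero}  _         = refl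
≤⇒<ᵇ-false {suc m} {suc n} (s≤s n≤m) = ≤⇒<ᵇ-false n≤m

<ᵇ-true⇒< : ∀ m n → (m <ᵇ n) ≡ true → m < n
<ᵇ-true⇒< m n e = <ᵇ⇒< m n (Equivalence.from T-≡ e)

<ᵇ-flip : ∀ m n → m ≢ n → (n <ᵇ m) ≡ not (m <ᵇ n)
<ᵇ-flip zero    zero    ne = ⊥-elim (ne refl)
<ᵇ-flip zero    (suc n) ne = refl
<ᵇ-flip (suc m) zero    ne = refl
<ᵇ-flip (suc m) (suc n) ne = <ᵇ-flip m n (λ e → ne (cong suc e))

data Cmp (m n : ℕ) : Set where
  lt : m < n → Cmp m n
  gt : n < m → Cmp m n

cmp : ∀ m n → m ≢ n → Cmp m n
cmp m n m≢n with <-cmp m n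
... | tri< m<n _ _ = lt m<n
... | tri≈ _ m≡n _ = ⊥-elim (m≢n m≡n)
... | tri> _ _ n<m = gt n<m

module _ {A : Set} where

  count-++ : ∀ (p : A → Bool) xs ys → count p (xs ++ ys) ≡ count p xs + count p ys
  count-++ p []       ys = refl
  count-++ p (x ∷ xs) ys =
    trans (cong (_ +_) (count-++ p xs ys)) (sym (+-assoc (if p x then 1 else 0) _ _))

  count-cong : ∀ (p q : A → Bool) xs → (∀ x → x ∈ xs → p x ≡ q x) → count p xs ≡ count q xs
  count-cong p q []       h = refl
  count-cong p q (x ∷ xs) h
    rewrite h x (here refl) | count-cong p q xs (λ y m → h y (there m)) = refl

  count-none : ∀ (p : A → Bool) xs → (∀ x → x ∈ xs → p x ≡ false) → count p xs ≡ 0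
  count-none p []       h = refl
  count-none p (x ∷ xs) h rewrite h x (here refl) = count-none p xs (λ y m → h y (there m))

  count-∨ : ∀ (p q : A → Bool) xs → (∀ x → x ∈ xs → p x ∧ q x ≡ false) →
    count (λ x → p x ∨ q x) xs ≡ count p xs + count q xs
  count-∨ p q []       h = refl
  count-∨ p q (x ∷ xs) h with p x in px | q x in qx | count-∨ p q xs (λ y m → h y (there m))
  ... | true  | true  | _  with () ← trans (sym (cong₂ _∧_ px qx)) (h x (here refl))
  ... | true  | false | ih = cong suc ih
  ... | false | true  | ih = trans (cong suc ih) (sym (+-suc (count p xs) (count q xs)))
  ... | false | false | ih = ih

  any-cong : ∀ (p q : A → Bool) xs → (∀ x → x ∈ xs → p x ≡ q x) → any p xs ≡ any q xs
  any-cong p q []       h = refl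
  any-cong p q (x ∷ xs) h rewrite h x (here refl) | any-cong p q xs (λ y m → h y (there m)) = refl

  all-cong : ∀ (p q : A → Bool) xs → (∀ x → x ∈ xs → p x ≡ q x) → all p xs ≡ all q xs
  all-cong p q []       h = refl
  all-cong p q (x ∷ xs) h rewrite h x (here refl) | all-cong p q xs (λ y m → h y (there m)) = refl

  any-true⁻ : ∀ (p : A → Bool) xs → any p xs ≡ true → ∃ λ x → x ∈ xs × p x ≡ true
  any-true⁻ p (x ∷ xs) e with p x in px
  ... | true  = x , here refl , px
  ... | false with any-true⁻ p xs e
  ... | y , y∈xs , py = y , there y∈xs , py

  any-true⁺ : ∀ (p : A → Bool) {xs x} → x ∈ xs → p x ≡ true → any p xs ≡ true
  any-true⁺ p {y ∷ xs} (here refl) e rewrite e = refl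
  any-true⁺ p {y ∷ xs} (there m)   e = ∨-trueʳ (p y) (any-true⁺ p m e)

  all-true⁻ : ∀ (p : A → Bool) xs → all p xs ≡ true → ∀ {x} → x ∈ xs → p x ≡ true
  all-true⁻ p (y ∷ xs) e (here refl) = ∧-conicalˡ _ _ e
  all-true⁻ p (y ∷ xs) e (there m)   = all-true⁻ p xs (∧-conicalʳ (p y) _ e) m

  all-true⁺ : ∀ (p : A → Bool) xs → (∀ x → x ∈ xs → p x ≡ true) → all p xs ≡ true
  all-true⁺ p []       h = refl
  all-true⁺ p (x ∷ xs) h rewrite h x (here refl) = all-true⁺ p xs (λ y m → h y (there m))

  all-false⁺ : ∀ (p : A → Bool) {xs x} → x ∈ xs → p x ≡ false → all p xs ≡ false
  all-false⁺ p {y ∷ xs} (here refl) e rewrite e = refl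
  all-false⁺ p {y ∷ xs} (there m)   e rewrite all-false⁺ p m e = ∧-zeroʳ (p y)

  all-++ : ∀ (p : A → Bool) xs ys → all p (xs ++ ys) ≡ all p xs ∧ all p ys
  all-++ p []       ys = refl
  all-++ p (x ∷ xs) ys rewrite all-++ p xs ys with p x
  ... | true  = refl
  ... | false = refl

module _ {A B : Set} where

  count-map : ∀ (p : B → Bool) (f : A → B) xs → count p (map f xs) ≡ count (λ x → p (f x)) xs
  count-map p f []       = refl
  count-map p f (x ∷ xs) = cong (_ +_) (count-map p f xs)

  any-map : ∀ (p : B → Bool) (f : A → B) xs → any p (map f xs) ≡ any (λ x → p (f x)) xs
  any-map p f []       = refl
  any-map p f (x ∷ xs) = cong (p (f x) ∨_) (any-map p f xs)

  all-map : ∀ (p : B → Bool) (f : A → B) xs → all p (map f xs) ≡ all (λ x → p (f x)) xs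
  all-map p f []       = refl
  all-map p f (x ∷ xs) = cong (p (f x) ∧_) (all-map p f xs)

distinct-tail : ∀ {x xs} → distinct (x ∷ xs) ≡ true → distinct xs ≡ true
distinct-tail {x} {xs} = ∧-conicalʳ (not (any (x ≡ᵇ_) xs)) _

distinct-head : ∀ {x xs y} → distinct (x ∷ xs) ≡ true → y ∈ xs → x ≢ y
distinct-head {x} {xs} d y∈xs refl = case (not-injective (∧-conicalˡ _ _ d))
  where
  case : any (x ≡ᵇ_) xs ≡ false → ⊥
  case e with () ← trans (sym (any-true⁺ (x ≡ᵇ_) y∈xs (≡ᵇ-refl x))) e

⊆-distinct : ∀ {s l} → s ⊆ l → distinct l ≡ true → distinct s ≡ true
⊆-distinct []                           d = refl
⊆-distinct {l = y ∷ l} (_ ∷ʳ s⊆l)       d = ⊆-distinct s⊆l (distinct-tail {y} {l} d)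
⊆-distinct {x ∷ s} {x ∷ l} (refl ∷ s⊆l) d =
  cong₂ _∧_ (cong not x∉s) (⊆-distinct s⊆l (distinct-tail {x} {l} d))
  where
  x∉s : any (x ≡ᵇ_) s ≡ false
  x∉s with any (x ≡ᵇ_) s in e
  ... | false = refl
  ... | true with any-true⁻ (x ≡ᵇ_) s e
  ... | y , y∈s , x≡y = ⊥-elim (distinct-head d (lookup s⊆l y∈s) (≡ᵇ-sound x y x≡y))

choose-⊆ : ∀ k l {t} → t ∈ choose k l → t ⊆ l
choose-⊆ zero    l       (here refl) = minimum l
choose-⊆ (suc k) (x ∷ l) t∈ with ∈-++⁻ (map (x ∷_) (choose k l)) t∈
... | inj₂ t∈rest = x ∷ʳ choose-⊆ (suc k) l t∈rest
... | inj₁ t∈head with ∈-map⁻ (x ∷_) t∈head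
... | t′ , t′∈ , refl = refl ∷ choose-⊆ k l t′∈

choose-distinct : ∀ k l {t} → distinct l ≡ true → t ∈ choose k l → distinct t ≡ true
choose-distinct k l d t∈ = ⊆-distinct (choose-⊆ k l t∈) d

choose-map : ∀ (g : ℕ → ℕ) k l → choose k (map g l) ≡ map (map g) (choose k l)
choose-map g zero    l       = refl
choose-map g (suc k) []      = refl
choose-map g (suc k) (x ∷ l)
  rewrite choose-map g k l | choose-map g (suc k) l
        | map-++ (map g) (map (x ∷_) (choose k l)) (choose (suc k) l) =
  cong (_++ map (map g) (choose (suc k) l)) (trans (sym (map-∘ (choose k l))) (map-∘ (choose k l)))

choose-length : ∀ k l {t} → t ∈ choose k l → length t ≡ k
choose-length zero    l       (here refl) = refl
choose-length (suc k) (x ∷ l) t∈ with ∈-++⁻ (map (x ∷_) (choose k l)) t∈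
... | inj₂ t∈rest = choose-length (suc k) l t∈rest
... | inj₁ t∈head with ∈-map⁻ (x ∷_) t∈head
... | t′ , t′∈ , refl = cong suc (choose-length k l t′∈)

module _ {A : Set} (q : A → Bool) where

  filterᵇ-unique : ∀ (g : List A → List A) → g [] ≡ [] →
    (∀ l ls → g (l ∷ ls) ≡ (if q l then l ∷ g ls else g ls)) → ∀ L → g L ≡ filterᵇ q L
  filterᵇ-unique g g-[] g-∷ []      = g-[]
  filterᵇ-unique g g-[] g-∷ (x ∷ L) rewrite g-∷ x L | filterᵇ-unique g g-[] g-∷ L with q x
  ... | true  = refl
  ... | false = refl

  count-filterᵇ : ∀ (p : A → Bool) L → count p (filterᵇ q L) ≡ count (λ x → q x ∧ p x) L
  count-filterᵇ p []      = refl
  count-filterᵇ p (x ∷ L) with q x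
  ... | true  = cong (_ +_) (count-filterᵇ p L)
  ... | false = count-filterᵇ p L

-- Defs filters with functions local to S and Av; abstracting their list argument lets
-- filterᵇ-unique identify those functions.
S≡filterᵇ : ∀ n → S n ≡ filterᵇ distinct (allLists n n)
S≡filterᵇ n with filterᵇ-unique distinct _ refl (λ _ _ → refl) | allLists n n
... | S≡ | L = S≡ L

Av≡filterᵇ : ∀ n pats → Av n pats ≡ filterᵇ (avoidsAll pats) (S n)
Av≡filterᵇ n pats with filterᵇ-unique (avoidsAll pats) _ refl (λ _ _ → refl) | S n
... | Av≡ | L = Av≡ L

data Pattern : Set where
  p123 p132 p213 p231 p312 p321 : Pattern

oneLine : Pattern → List ℕ
oneLine p123 = 1 ∷ 2 ∷ 3 ∷ []
oneLine p132 = 1 ∷ 3 ∷ 2 ∷ []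
oneLine p213 = 2 ∷ 1 ∷ 3 ∷ []
oneLine p231 = 2 ∷ 3 ∷ 1 ∷ []
oneLine p312 = 3 ∷ 1 ∷ 2 ∷ []
oneLine p321 = 3 ∷ 2 ∷ 1 ∷ []

patterns : List Pattern
patterns = p123 ∷ p132 ∷ p213 ∷ p231 ∷ p312 ∷ p321 ∷ []

∈-patterns : ∀ ρ → ρ ∈ patterns
∈-patterns p123 = here refl
∈-patterns p132 = there (here refl)
∈-patterns p213 = there (there (here refl))
∈-patterns p231 = there (there (there (here refl)))
∈-patterns p312 = there (there (there (there (here refl))))
∈-patterns p321 = there (there (there (there (there (here refl)))))

S3≡oneLine : ∀ {σ} → σ ∈ S 3 → ∃ λ ρ → σ ≡ oneLine ρ
S3≡oneLine (here refl)                                         = p123 , refl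
S3≡oneLine (there (here refl))                                 = p132 , refl
S3≡oneLine (there (there (here refl)))                         = p213 , refl
S3≡oneLine (there (there (there (here refl))))                 = p231 , refl
S3≡oneLine (there (there (there (there (here refl)))))         = p312 , refl
S3≡oneLine (there (there (there (there (there (here refl)))))) = p321 , refl

-- The argument lists the comparisons x < y, y < z, x < z of a triple x y z; the two
-- inconsistent combinations are not the comparisons of any triple.
orderType : Bool × Bool × Bool → Maybe Pattern
orderType (true  , true  , true)  = just p123
orderType (true  , false , true)  = just p132
orderType (false , true  , true)  = just p213
orderType (true  , false , false) = just p231
orderType (false , true  , false) = just p312
orderType (false , false , false) = just p321
orderType (true  , true  , false) = nothing
orderType (false , false , true)  = nothing

patternOf : List ℕ → Maybe Pattern
patternOf (x ∷ y ∷ z ∷ []) = orderType ((x <ᵇ y) , (y <ᵇ z) , (x <ᵇ z))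
patternOf _                = nothing

comparisons : Pattern → Bool × Bool × Bool
comparisons p123 = true  , true  , true
comparisons p132 = true  , false , true
comparisons p213 = false , true  , true
comparisons p231 = true  , false , false
comparisons p312 = false , true  , false
comparisons p321 = false , false , false

orderType-just : ∀ c {ρ} → orderType c ≡ just ρ → c ≡ comparisons ρ
orderType-just (true  , true  , true)  refl = refl
orderType-just (true  , false , true)  refl = refl
orderType-just (false , true  , true)  refl = refl
orderType-just (true  , false , false) refl = refl
orderType-just (false , true  , false) refl = refl
orderType-just (false , false , false) refl = refl

orderType-comparisons : ∀ ρ → orderType (comparisons ρ) ≡ just ρ
orderType-comparisons p123 = refl
orderType-comparisons p132 = refl
orderType-comparisons p213 = refl
orderType-comparisons p231 = refl
orderType-comparisons p312 = refl
orderType-comparisons p321 = refl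

data DistinctTriple : List ℕ → Set where
  triple : ∀ {x y z} → x ≢ y → y ≢ z → x ≢ z → DistinctTriple (x ∷ y ∷ z ∷ [])

distinctTriple : ∀ {t} → length t ≡ 3 → distinct t ≡ true → DistinctTriple t
distinctTriple {x ∷ y ∷ z ∷ []} refl d =
  triple (distinct-head {x} {y ∷ z ∷ []} d (here refl))
         (distinct-head {y} {z ∷ []} (distinct-tail {x} {y ∷ z ∷ []} d) (here refl))
         (distinct-head {x} {y ∷ z ∷ []} d (there (here refl)))

oneLine-triple : ∀ ρ → DistinctTriple (oneLine ρ)
oneLine-triple p123 = triple (λ ()) (λ ()) (λ ())
oneLine-triple p132 = triple (λ ()) (λ ()) (λ ())
oneLine-triple p213 = triple (λ ()) (λ ()) (λ ())
oneLine-triple p231 = triple (λ ()) (λ ()) (λ ())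
oneLine-triple p312 = triple (λ ()) (λ ()) (λ ())
oneLine-triple p321 = triple (λ ()) (λ ()) (λ ())

comparisonsOf : List ℕ → Bool × Bool × Bool
comparisonsOf (x ∷ y ∷ z ∷ []) = (x <ᵇ y) , (y <ᵇ z) , (x <ᵇ z)
comparisonsOf _                = false , false , false

comparisonsOf-oneLine : ∀ ρ → comparisonsOf (oneLine ρ) ≡ comparisons ρ
comparisonsOf-oneLine p123 = refl
comparisonsOf-oneLine p132 = refl
comparisonsOf-oneLine p213 = refl
comparisonsOf-oneLine p231 = refl
comparisonsOf-oneLine p312 = refl
comparisonsOf-oneLine p321 = refl

-- The shape in which sameOrder compares two triples once y < x is read as not (x < y).
comparisons-== : ∀ a b c a′ b′ c′ →
  ((not a == not a′) ∧ ((not c == not c′) ∧ true)) ∧ (((not b == not b′) ∧ true) ∧ true) ≡ true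
  ⇔ (a , b , c) ≡ (a′ , b′ , c′)
comparisons-== a b c a′ b′ c′ = mk⇔ to from
  where
  agree : ∀ {u v} → (not u == not v) ≡ true → u ≡ v
  agree e = not-injective (==-sound e)
  to : ((not a == not a′) ∧ ((not c == not c′) ∧ true)) ∧ (((not b == not b′) ∧ true) ∧ true) ≡ true →
       (a , b , c) ≡ (a′ , b′ , c′)
  to e = cong₂ _,_ (agree (∧-conicalˡ A (C ∧ true) eAC))
           (cong₂ _,_ (agree (∧-conicalˡ B true (∧-conicalˡ (B ∧ true) true (∧-conicalʳ (A ∧ (C ∧ true)) _ e))))
                      (agree (∧-conicalˡ C true (∧-conicalʳ A (C ∧ true) eAC))))
    where
    A = not a == not a′
    B = not b == not b′
    C = not c == not c′
    eAC = ∧-conicalˡ (A ∧ (C ∧ true)) ((B ∧ true) ∧ true) e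
  from : (a , b , c) ≡ (a′ , b′ , c′) →
         ((not a == not a′) ∧ ((not c == not c′) ∧ true)) ∧ (((not b == not b′) ∧ true) ∧ true) ≡ true
  from refl rewrite ==-refl (not a) | ==-refl (not b) | ==-refl (not c) = refl

sameOrder-triple : ∀ {t t′} → DistinctTriple t → DistinctTriple t′ →
  sameOrder t t′ ≡ true ⇔ comparisonsOf t ≡ comparisonsOf t′
sameOrder-triple {x ∷ y ∷ z ∷ []} {x′ ∷ y′ ∷ z′ ∷ []} (triple x≢y y≢z x≢z) (triple x′≢y′ y′≢z′ x′≢z′)
  rewrite <ᵇ-flip x y x≢y | <ᵇ-flip y z y≢z | <ᵇ-flip x z x≢z
        | <ᵇ-flip x′ y′ x′≢y′ | <ᵇ-flip y′ z′ y′≢z′ | <ᵇ-flip x′ z′ x′≢z′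
  = comparisons-== (x <ᵇ y) (y <ᵇ z) (x <ᵇ z) (x′ <ᵇ y′) (y′ <ᵇ z′) (x′ <ᵇ z′)

patternOf-triple : ∀ {t} → DistinctTriple t → patternOf t ≡ orderType (comparisonsOf t)
patternOf-triple (triple _ _ _) = refl

sameOrder-oneLine : ∀ {t} ρ → DistinctTriple t → sameOrder t (oneLine ρ) ≡ true ⇔ patternOf t ≡ just ρ
sameOrder-oneLine ρ tt = mk⇔
  (λ e → trans (patternOf-triple tt)
           (trans (cong orderType (trans (Equivalence.to same e) (comparisonsOf-oneLine ρ)))
                  (orderType-comparisons ρ)))
  (λ e → Equivalence.from same
           (trans (orderType-just _ (trans (sym (patternOf-triple tt)) e)) (sym (comparisonsOf-oneLine ρ))))
  where same = sameOrder-triple tt (oneLine-triple ρ)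

contains-oneLine≡ : ∀ l ρ → contains l (oneLine ρ) ≡ any (λ s → sameOrder s (oneLine ρ)) (choose 3 l)
contains-oneLine≡ l p123 = refl
contains-oneLine≡ l p132 = refl
contains-oneLine≡ l p213 = refl
contains-oneLine≡ l p231 = refl
contains-oneLine≡ l p312 = refl
contains-oneLine≡ l p321 = refl

contains-oneLine : ∀ l ρ → distinct l ≡ true →
  contains l (oneLine ρ) ≡ true ⇔ (∃ λ t → t ∈ choose 3 l × patternOf t ≡ just ρ)
contains-oneLine l ρ d rewrite contains-oneLine≡ l ρ = mk⇔ to from
  where
  tripleOf : ∀ {t} → t ∈ choose 3 l → DistinctTriple t
  tripleOf t∈ = distinctTriple (choose-length 3 l t∈) (choose-distinct 3 l d t∈)
  to : any (λ s → sameOrder s (oneLine ρ)) (choose 3 l) ≡ true → ∃ λ t → t ∈ choose 3 l × patternOf t ≡ just ρ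
  to e with any-true⁻ _ (choose 3 l) e
  ... | t , t∈ , so = t , t∈ , Equivalence.to (sameOrder-oneLine ρ (tripleOf t∈)) so
  from : (∃ λ t → t ∈ choose 3 l × patternOf t ≡ just ρ) → any (λ s → sameOrder s (oneLine ρ)) (choose 3 l) ≡ true
  from (t , t∈ , e) = any-true⁺ _ t∈ (Equivalence.from (sameOrder-oneLine ρ (tripleOf t∈)) e)

forbidden : (Pattern → Bool) → List ℕ → Bool
forbidden B t = maybe′ B false (patternOf t)

avoids : (Pattern → Bool) → List ℕ → Bool
avoids B l = all (λ t → not (forbidden B t)) (choose 3 l)

patternSet : List (List ℕ) → Pattern → Bool
patternSet pats ρ = does (oneLine ρ ∈ᴸ? pats)

avoidsAll≡avoids : ∀ pats → All (_∈ S 3) pats → ∀ l → distinct l ≡ true →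
  avoidsAll pats l ≡ avoids (patternSet pats) l
avoidsAll≡avoids pats pats⊆S3 l d = bool-ext to from
  where
  B = patternSet pats
  to : avoidsAll pats l ≡ true → avoids B l ≡ true
  to h = all-true⁺ _ (choose 3 l) allowed
    where
    allowed : ∀ t → t ∈ choose 3 l → not (forbidden B t) ≡ true
    allowed t t∈ with patternOf t in pt
    ... | nothing = refl
    ... | just ρ with oneLine ρ ∈ᴸ? pats
    ...   | no  _     = refl
    ...   | yes ρ∈pats with () ← trans (sym (Equivalence.from (contains-oneLine l ρ d) (t , t∈ , pt)))
                                      (not-injective (all-true⁻ _ pats h ρ∈pats))
  from : avoids B l ≡ true → avoidsAll pats l ≡ true
  from h = all-true⁺ _ pats avoided
    where
    avoided : ∀ σ → σ ∈ pats → not (contains l σ) ≡ true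
    avoided σ σ∈pats with S3≡oneLine (All.lookup pats⊆S3 σ∈pats)
    ... | ρ , refl with contains l (oneLine ρ) in c
    ... | false = refl
    ... | true with Equivalence.to (contains-oneLine l ρ d) c
    ... | t , t∈ , pt with () ← trans (sym (not-injective (all-true⁻ _ (choose 3 l) h t∈)))
                                      (trans (cong (maybe′ B false) pt) (dec-true (oneLine ρ ∈ᴸ? pats) σ∈pats))

inAv : (Pattern → Bool) → List ℕ → Bool
inAv B l = distinct l ∧ avoids B l

countAv : (Pattern → Bool) → (List ℕ → Bool) → ℕ → ℕ
countAv B p n = count (λ l → inAv B l ∧ p l) (allLists n n)

AvBalanced : (Pattern → Bool) → ℕ → Set
AvBalanced B n = countAv B isEven n ≡ countAv B isOdd n

count-Av : ∀ pats → All (_∈ S 3) pats → ∀ (p : List ℕ → Bool) n →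
  count p (Av n pats) ≡ countAv (patternSet pats) p n
count-Av pats pats⊆S3 p n =
  trans (cong (count p) (Av≡filterᵇ n pats))
  (trans (count-filterᵇ (avoidsAll pats) p (S n))
  (trans (cong (count _) (S≡filterᵇ n))
  (trans (count-filterᵇ distinct _ (allLists n n))
         (count-cong _ _ (allLists n n) reassociate))))
  where
  reassociate : ∀ l → l ∈ allLists n n →
    distinct l ∧ (avoidsAll pats l ∧ p l) ≡ inAv (patternSet pats) l ∧ p l
  reassociate l _ with distinct l in d
  ... | false = refl
  ... | true  = cong (_∧ p l) (avoidsAll≡avoids pats pats⊆S3 l d)

sumBy : {A : Set} → (A → ℕ) → List A → ℕ
sumBy f []       = 0
sumBy f (x ∷ xs) = f x + sumBy f xs

module _ {A : Set} where

  sumBy-++ : ∀ (f : A → ℕ) xs ys → sumBy f (xs ++ ys) ≡ sumBy f xs + sumBy f ys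
  sumBy-++ f []       ys = refl
  sumBy-++ f (x ∷ xs) ys = trans (cong (f x +_) (sumBy-++ f xs ys)) (sym (+-assoc (f x) _ _))

  sumBy-cong : ∀ (f g : A → ℕ) xs → (∀ x → x ∈ xs → f x ≡ g x) → sumBy f xs ≡ sumBy g xs
  sumBy-cong f g []       h = refl
  sumBy-cong f g (x ∷ xs) h = cong₂ _+_ (h x (here refl)) (sumBy-cong f g xs (λ y m → h y (there m)))

  sumBy-+ : ∀ (f g : A → ℕ) xs → sumBy (λ x → f x + g x) xs ≡ sumBy f xs + sumBy g xs
  sumBy-+ f g []       = refl
  sumBy-+ f g (x ∷ xs) = trans (cong (f x + g x +_) (sumBy-+ f g xs)) (+-interchange (f x) (g x) _ _)

  sumBy-0 : ∀ (xs : List A) → sumBy (λ _ → 0) xs ≡ 0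
  sumBy-0 []       = refl
  sumBy-0 (x ∷ xs) = sumBy-0 xs

sumBy-comm : ∀ {A B : Set} (F : A → B → ℕ) xs ys →
  sumBy (λ x → sumBy (F x) ys) xs ≡ sumBy (λ y → sumBy (λ x → F x y) xs) ys
sumBy-comm F []       ys = sym (sumBy-0 ys)
sumBy-comm F (x ∷ xs) ys =
  trans (cong (sumBy (F x) ys +_) (sumBy-comm F xs ys)) (sym (sumBy-+ (F x) _ ys))

count-concatMap : ∀ {A B : Set} (p : B → Bool) (f : A → List B) xs →
  count p (concatMap f xs) ≡ sumBy (λ x → count p (f x)) xs
count-concatMap p f []       = refl
count-concatMap p f (x ∷ xs) = trans (count-++ p (f x) _) (cong (_ +_) (count-concatMap p f xs))

oneTo : ℕ → List ℕ
oneTo m = map suc (upTo m)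

count-allLists-suc : ∀ (p : List ℕ → Bool) k m →
  count p (allLists (suc k) m) ≡ sumBy (λ x → count (λ l → p (x ∷ l)) (allLists k m)) (oneTo m)
count-allLists-suc p k m =
  trans (count-concatMap p (λ x → map (x ∷_) (allLists k m)) (oneTo m))
        (sumBy-cong _ _ (oneTo m) (λ x _ → count-map p (x ∷_) (allLists k m)))

count-allLists-suc₂ : ∀ (p : List ℕ → Bool) k m → count p (allLists (suc (suc k)) m) ≡
  sumBy (λ x → sumBy (λ y → count (λ l → p (x ∷ y ∷ l)) (allLists k m)) (oneTo m)) (oneTo m)
count-allLists-suc₂ p k m = trans (count-allLists-suc p (suc k) m)
  (sumBy-cong _ _ (oneTo m) (λ x _ → count-allLists-suc (λ l → p (x ∷ l)) k m))

∈-allLists-suc⁻ : ∀ k m {l} → l ∈ allLists (suc k) m →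
  ∃ λ x → ∃ λ l′ → l ≡ x ∷ l′ × x ∈ oneTo m × l′ ∈ allLists k m
∈-allLists-suc⁻ k m l∈ with find (∈-concatMap⁻ (λ x → map (x ∷_) (allLists k m)) {xs = oneTo m} l∈)
... | x , x∈ , l∈x∷ with ∈-map⁻ (x ∷_) l∈x∷
... | l′ , l′∈ , refl = x , l′ , refl , x∈ , l′∈

allLists-length : ∀ k m {l} → l ∈ allLists k m → length l ≡ k
allLists-length zero    m (here refl) = refl
allLists-length (suc k) m l∈ with ∈-allLists-suc⁻ k m l∈
... | _ , l′ , refl , _ , l′∈ = cong suc (allLists-length k m l′∈)

allLists-entries : ∀ k m {l} → l ∈ allLists k m → ∀ {y} → y ∈ l → y ∈ oneTo m
allLists-entries zero    m (here refl) ()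
allLists-entries (suc k) m l∈ y∈ with ∈-allLists-suc⁻ k m l∈
allLists-entries (suc k) m l∈ (here refl) | _ , _ , refl , x∈ , _   = x∈
allLists-entries (suc k) m l∈ (there y∈)  | _ , _ , refl , _ , l′∈ = allLists-entries k m l′∈ y∈

-- Sign-reversing involutions

Rearranges : {A : Set} → (A → A) → List A → Set
Rearranges f L = ∀ p → count (λ x → p (f x)) L ≡ count p L

count-∧-transport : ∀ {A : Set} (f : A → A) L (P e o : A → Bool) → Rearranges f L →
  (∀ x → x ∈ L → P (f x) ≡ P x) → (∀ x → x ∈ L → P x ≡ true → e (f x) ≡ o x) →
  count (λ x → P x ∧ e x) L ≡ count (λ x → P x ∧ o x) L
count-∧-transport f L P e o f-rearranges P∘f≡P e∘f≡o =
  trans (sym (f-rearranges (λ x → P x ∧ e x))) (count-cong _ _ L flipped)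
  where
  flipped : ∀ x → x ∈ L → P (f x) ∧ e (f x) ≡ P x ∧ o x
  flipped x x∈ rewrite P∘f≡P x x∈ with P x in Px
  ... | false = refl
  ... | true  = e∘f≡o x x∈ Px

allLists-≤-length : ∀ {k n l} → k ≤ n → l ∈ allLists n n → k ≤ length l
allLists-≤-length k≤n l∈ = subst (_ ≤_) (sym (allLists-length _ _ l∈)) k≤n

OneApart : ℕ → ℕ → Set
OneApart m n = m ≡ suc n ⊎ suc m ≡ n

even-suc : ∀ m → (suc m % 2 ≡ᵇ 0) ≡ not (m % 2 ≡ᵇ 0)
even-suc zero    = refl
even-suc (suc m) =
  trans (cong (_≡ᵇ 0) (trans (cong (_% 2) (+-comm 2 m)) ([m+n]%n≡m%n m 2)))
        (sym (trans (cong not (even-suc m)) (not-involutive _)))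

oneApart-parity : ∀ l′ l → OneApart (inv l′) (inv l) → isEven l′ ≡ isOdd l
oneApart-parity l′ l (inj₁ e) rewrite e = even-suc (inv l)
oneApart-parity l′ l (inj₂ e) rewrite sym e = trans (sym (not-involutive _)) (cong not (sym (even-suc (inv l′))))

AvBalanced-by-sign-reversal : ∀ B n (f : List ℕ → List ℕ) → Rearranges f (allLists n n) →
  (∀ l → l ∈ allLists n n → distinct (f l) ≡ distinct l) →
  (∀ l → l ∈ allLists n n → distinct l ≡ true → avoids B (f l) ≡ avoids B l) →
  (∀ l → l ∈ allLists n n → distinct l ≡ true → OneApart (inv (f l)) (inv l)) →
  AvBalanced B n
AvBalanced-by-sign-reversal B n f f-rearranges f-distinct f-avoids f-inv =
  count-∧-transport f (allLists n n) (inAv B) isEven isOdd f-rearranges inAv∘f parity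
  where
  inAv∘f : ∀ l → l ∈ allLists n n → inAv B (f l) ≡ inAv B l
  inAv∘f l l∈ rewrite f-distinct l l∈ with distinct l in d
  ... | false = refl
  ... | true  = f-avoids l l∈ d
  parity : ∀ l → l ∈ allLists n n → inAv B l ≡ true → isEven (f l) ≡ isOdd l
  parity l l∈ e = oneApart-parity (f l) l (f-inv l l∈ (∧-conicalˡ (distinct l) _ e))

swapPositions₁₂ swapPositions₂₃ swapValues₁₂ swapValues₂₃ : Pattern → Pattern
swapPositions₁₂ p123 = p213
swapPositions₁₂ p132 = p312
swapPositions₁₂ p213 = p123
swapPositions₁₂ p231 = p321
swapPositions₁₂ p312 = p132
swapPositions₁₂ p321 = p231
swapPositions₂₃ p123 = p132
swapPositions₂₃ p132 = p123
swapPositions₂₃ p213 = p231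
swapPositions₂₃ p231 = p213
swapPositions₂₃ p312 = p321
swapPositions₂₃ p321 = p312
swapValues₁₂ p123 = p213
swapValues₁₂ p132 = p231
swapValues₁₂ p213 = p123
swapValues₁₂ p231 = p132
swapValues₁₂ p312 = p321
swapValues₁₂ p321 = p312
swapValues₂₃ p123 = p132
swapValues₂₃ p132 = p123
swapValues₂₃ p213 = p312
swapValues₂₃ p231 = p321
swapValues₂₃ p312 = p213
swapValues₂₃ p321 = p231

InvariantUnder : (Pattern → Pattern) → (Pattern → Bool) → Set
InvariantUnder τ B = ∀ ρ → B (τ ρ) ≡ B ρ

forbidden-invariant : ∀ {τ B} → InvariantUnder τ B → ∀ t′ t →
  patternOf t′ ≡ Maybe.map τ (patternOf t) → forbidden B t′ ≡ forbidden B t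
forbidden-invariant {B = B} B∘τ≡B t′ t e with patternOf t
... | nothing = cong (maybe′ B false) e
... | just ρ  = trans (cong (maybe′ B false) e) (B∘τ≡B ρ)

orderType-swapPositions₁₂ : ∀ a b c →
  orderType (not a , c , b) ≡ Maybe.map swapPositions₁₂ (orderType (a , b , c))
orderType-swapPositions₁₂ true  true  true  = refl
orderType-swapPositions₁₂ true  true  false = refl
orderType-swapPositions₁₂ true  false true  = refl
orderType-swapPositions₁₂ true  false false = refl
orderType-swapPositions₁₂ false true  true  = refl
orderType-swapPositions₁₂ false true  false = refl
orderType-swapPositions₁₂ false false true  = refl
orderType-swapPositions₁₂ false false false = refl

orderType-swapPositions₂₃ : ∀ a b c →
  orderType (c , not b , a) ≡ Maybe.map swapPositions₂₃ (orderType (a , b , c))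
orderType-swapPositions₂₃ true  true  true  = refl
orderType-swapPositions₂₃ true  true  false = refl
orderType-swapPositions₂₃ true  false true  = refl
orderType-swapPositions₂₃ true  false false = refl
orderType-swapPositions₂₃ false true  true  = refl
orderType-swapPositions₂₃ false true  false = refl
orderType-swapPositions₂₃ false false true  = refl
orderType-swapPositions₂₃ false false false = refl

swapFront : List ℕ → List ℕ
swapFront (x ∷ y ∷ r) = y ∷ x ∷ r
swapFront l           = l

swapFront-rearranges : ∀ k m → Rearranges swapFront (allLists k m)
swapFront-rearranges zero          m p = refl
swapFront-rearranges (suc zero)    m p =
  trans (count-allLists-suc _ 0 m) (sym (count-allLists-suc p 0 m))
swapFront-rearranges (suc (suc k)) m p =
  trans (count-allLists-suc₂ (λ l → p (swapFront l)) k m)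
    (trans (sumBy-comm (λ x y → count (λ l → p (y ∷ x ∷ l)) (allLists k m)) (oneTo m) (oneTo m))
           (sym (count-allLists-suc₂ p k m)))

swapFront-distinct : ∀ l → distinct (swapFront l) ≡ distinct l
swapFront-distinct []          = refl
swapFront-distinct (x ∷ [])    = refl
swapFront-distinct (x ∷ y ∷ r) rewrite ≡ᵇ-sym y x =
  shuffle (x ≡ᵇ y) (any (x ≡ᵇ_) r) (any (y ≡ᵇ_) r) (distinct r)
  where
  shuffle : ∀ a b c d → not (a ∨ c) ∧ (not b ∧ d) ≡ not (a ∨ b) ∧ (not c ∧ d)
  shuffle true  b     c     d = refl
  shuffle false true  true  d = refl
  shuffle false true  false d = refl
  shuffle false false true  d = refl
  shuffle false false false d = refl

all-choose₃-∷∷ : ∀ (P : List ℕ → Bool) x y r → all P (choose 3 (x ∷ y ∷ r)) ≡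
  (all (λ t → P (x ∷ y ∷ t)) (choose 1 r) ∧ all (λ t → P (x ∷ t)) (choose 2 r)) ∧
  (all (λ t → P (y ∷ t)) (choose 2 r) ∧ all P (choose 3 r))
all-choose₃-∷∷ P x y r =
  trans (all-++ P (map (x ∷_) (choose 2 (y ∷ r))) (choose 3 (y ∷ r)))
    (cong₂ _∧_
      (trans (all-map P (x ∷_) (choose 2 (y ∷ r)))
        (trans (all-++ (λ t → P (x ∷ t)) (map (y ∷_) (choose 1 r)) (choose 2 r))
          (cong (_∧ _) (all-map (λ t → P (x ∷ t)) (y ∷_) (choose 1 r)))))
      (trans (all-++ P (map (y ∷_) (choose 2 r)) (choose 3 r))
        (cong (_∧ _) (all-map P (y ∷_) (choose 2 r)))))

patternOf-swapFront : ∀ x y t → x ≢ y →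
  patternOf (y ∷ x ∷ t) ≡ Maybe.map swapPositions₁₂ (patternOf (x ∷ y ∷ t))
patternOf-swapFront x y []          x≢y = refl
patternOf-swapFront x y (z ∷ [])    x≢y rewrite <ᵇ-flip x y x≢y =
  orderType-swapPositions₁₂ (x <ᵇ y) (y <ᵇ z) (x <ᵇ z)
patternOf-swapFront x y (_ ∷ _ ∷ _) x≢y = refl

avoids-swapFront : ∀ B → InvariantUnder swapPositions₁₂ B → ∀ x y r → x ≢ y →
  avoids B (y ∷ x ∷ r) ≡ avoids B (x ∷ y ∷ r)
avoids-swapFront B B∘τ≡B x y r x≢y =
  trans (all-choose₃-∷∷ P y x r)
    (trans (cong (λ b → (b ∧ Y) ∧ (X ∧ R))
                 (all-cong _ _ (choose 1 r) (λ t _ → cong not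
                   (forbidden-invariant B∘τ≡B (y ∷ x ∷ t) (x ∷ y ∷ t) (patternOf-swapFront x y t x≢y)))))
      (trans (∧-interchange (all (λ t → P (x ∷ y ∷ t)) (choose 1 r)) Y X R) (sym (all-choose₃-∷∷ P x y r))))
  where
  P = λ t → not (forbidden B t)
  X = all (λ t → P (x ∷ t)) (choose 2 r)
  Y = all (λ t → P (y ∷ t)) (choose 2 r)
  R = all P (choose 3 r)

inv-swapFront : ∀ x y r → x ≢ y → OneApart (inv (y ∷ x ∷ r)) (inv (x ∷ y ∷ r))
inv-swapFront x y r x≢y rewrite <ᵇ-flip y x (λ y≡x → x≢y (sym y≡x)) with y <ᵇ x
... | true  = inj₂ (cong suc (+-exchange (count (_<ᵇ y) r) (count (_<ᵇ x) r) (inv r)))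
... | false = inj₁ (cong suc (+-exchange (count (_<ᵇ y) r) (count (_<ᵇ x) r) (inv r)))

shape₂ : ∀ (l : List ℕ) → 2 ≤ length l → ∃ λ x → ∃ λ y → ∃ λ r → l ≡ x ∷ y ∷ r
shape₂ (x ∷ y ∷ r) _ = x , y , r , refl
shape₂ []          ()
shape₂ (x ∷ [])    (s≤s ())

AvBalanced-swapFront : ∀ B → InvariantUnder swapPositions₁₂ B → ∀ n → 2 ≤ n → AvBalanced B n
AvBalanced-swapFront B B∘τ≡B n 2≤n =
  AvBalanced-by-sign-reversal B n swapFront (swapFront-rearranges n n) (λ l _ → swapFront-distinct l)
    same-avoids one-apart
  where
  same-avoids : ∀ l → l ∈ allLists n n → distinct l ≡ true → avoids B (swapFront l) ≡ avoids B l
  same-avoids l l∈ d with shape₂ l (allLists-≤-length 2≤n l∈)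
  ... | x , y , r , refl = avoids-swapFront B B∘τ≡B x y r (distinct-head {x} {y ∷ r} d (here refl))
  one-apart : ∀ l → l ∈ allLists n n → distinct l ≡ true → OneApart (inv (swapFront l)) (inv l)
  one-apart l l∈ d with shape₂ l (allLists-≤-length 2≤n l∈)
  ... | x , y , r , refl = inv-swapFront x y r (distinct-head {x} {y ∷ r} d (here refl))

swapLast : List ℕ → List ℕ
swapLast (x ∷ y ∷ [])    = y ∷ x ∷ []
swapLast (x ∷ y ∷ z ∷ r) = x ∷ swapLast (y ∷ z ∷ r)
swapLast l               = l

swapLast-rearranges : ∀ k m → Rearranges swapLast (allLists k m)
swapLast-rearranges zero                m p = refl
swapLast-rearranges (suc zero)          m p =
  trans (count-allLists-suc _ 0 m) (sym (count-allLists-suc p 0 m))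
swapLast-rearranges (suc (suc zero))    m p =
  trans (count-allLists-suc₂ _ 0 m)
    (trans (sumBy-comm (λ x y → count (λ l → p (y ∷ x ∷ l)) (allLists 0 m)) (oneTo m) (oneTo m))
           (sym (count-allLists-suc₂ p 0 m)))
swapLast-rearranges (suc (suc (suc k))) m p =
  trans (count-allLists-suc _ (suc (suc k)) m)
    (trans (sumBy-cong _ _ (oneTo m) (λ x _ →
              trans (trans (count-allLists-suc₂ (λ l → p (swapLast (x ∷ l))) k m)
                           (sym (count-allLists-suc₂ (λ l → p (x ∷ swapLast l)) k m)))
                    (swapLast-rearranges (suc (suc k)) m (λ l → p (x ∷ l)))))
           (sym (count-allLists-suc p (suc (suc k)) m)))

any-swapLast : ∀ (q : ℕ → Bool) l → any q (swapLast l) ≡ any q l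
any-swapLast q []              = refl
any-swapLast q (x ∷ [])        = refl
any-swapLast q (x ∷ y ∷ [])    = trans (cong (q y ∨_) (∨-identityʳ (q x)))
                                   (trans (∨-comm (q y) (q x)) (cong (q x ∨_) (sym (∨-identityʳ (q y)))))
any-swapLast q (x ∷ y ∷ z ∷ r) = cong (q x ∨_) (any-swapLast q (y ∷ z ∷ r))

swapLast-distinct : ∀ l → distinct (swapLast l) ≡ distinct l
swapLast-distinct []              = refl
swapLast-distinct (x ∷ [])        = refl
swapLast-distinct (x ∷ y ∷ [])    = swapFront-distinct (x ∷ y ∷ [])
swapLast-distinct (x ∷ y ∷ z ∷ r) =
  cong₂ (λ a b → not a ∧ b) (any-swapLast (x ≡ᵇ_) (y ∷ z ∷ r)) (swapLast-distinct (y ∷ z ∷ r))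

shape-last₂ : ∀ (l : List ℕ) → 2 ≤ length l → ∃ λ pre → ∃ λ x → ∃ λ y → l ≡ pre ++ x ∷ y ∷ []
shape-last₂ (x ∷ y ∷ [])    _ = [] , x , y , refl
shape-last₂ (w ∷ y ∷ z ∷ r) _ with shape-last₂ (y ∷ z ∷ r) (s≤s (s≤s z≤n))
... | pre , a , b , e = w ∷ pre , a , b , cong (w ∷_) e
shape-last₂ []              ()
shape-last₂ (x ∷ [])        (s≤s ())

swapLast-++ : ∀ pre x y → swapLast (pre ++ x ∷ y ∷ []) ≡ pre ++ y ∷ x ∷ []
swapLast-++ []               x y = refl
swapLast-++ (w ∷ [])         x y = refl
swapLast-++ (w ∷ v ∷ [])     x y = refl
swapLast-++ (w ∷ v ∷ u ∷ pre) x y = cong (w ∷_) (swapLast-++ (v ∷ u ∷ pre) x y)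

all-choose-swapLast : ∀ (P : List ℕ → Bool) x y pre k →
  (∀ ws → P (ws ++ y ∷ x ∷ []) ≡ P (ws ++ x ∷ y ∷ [])) →
  all P (choose k (pre ++ y ∷ x ∷ [])) ≡ all P (choose k (pre ++ x ∷ y ∷ []))
all-choose-swapLast P x y []        zero                h = refl
all-choose-swapLast P x y []        (suc zero)          h =
  trans (sym (∧-assoc (P (y ∷ [])) (P (x ∷ [])) true))
        (trans (cong (_∧ true) (∧-comm (P (y ∷ [])) (P (x ∷ [])))) (∧-assoc (P (x ∷ [])) (P (y ∷ [])) true))
all-choose-swapLast P x y []        (suc (suc zero))    h = cong (_∧ true) (h [])
all-choose-swapLast P x y []        (suc (suc (suc k))) h = refl
all-choose-swapLast P x y (w ∷ pre) zero                h = refl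
all-choose-swapLast P x y (w ∷ pre) (suc k)             h =
  trans (all-++ P (map (w ∷_) (choose k (pre ++ y ∷ x ∷ []))) (choose (suc k) (pre ++ y ∷ x ∷ [])))
   (trans (cong₂ _∧_ (trans (all-map P (w ∷_) (choose k (pre ++ y ∷ x ∷ [])))
                       (trans (all-choose-swapLast (λ t → P (w ∷ t)) x y pre k (λ ws → h (w ∷ ws)))
                              (sym (all-map P (w ∷_) (choose k (pre ++ x ∷ y ∷ []))))))
                     (all-choose-swapLast P x y pre (suc k) h))
     (sym (all-++ P (map (w ∷_) (choose k (pre ++ x ∷ y ∷ []))) (choose (suc k) (pre ++ x ∷ y ∷ [])))))

patternOf-swapLast : ∀ ws x y → x ≢ y →
  patternOf (ws ++ y ∷ x ∷ []) ≡ Maybe.map swapPositions₂₃ (patternOf (ws ++ x ∷ y ∷ []))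
patternOf-swapLast []              x y x≢y = refl
patternOf-swapLast (w ∷ [])        x y x≢y rewrite <ᵇ-flip x y x≢y =
  orderType-swapPositions₂₃ (w <ᵇ x) (x <ᵇ y) (w <ᵇ y)
patternOf-swapLast (w ∷ v ∷ [])    x y x≢y = refl
patternOf-swapLast (w ∷ v ∷ u ∷ [])     x y x≢y = refl
patternOf-swapLast (w ∷ v ∷ u ∷ _ ∷ _) x y x≢y = refl

avoids-swapLast : ∀ B → InvariantUnder swapPositions₂₃ B → ∀ pre x y → x ≢ y →
  avoids B (pre ++ y ∷ x ∷ []) ≡ avoids B (pre ++ x ∷ y ∷ [])
avoids-swapLast B B∘τ≡B pre x y x≢y = all-choose-swapLast _ x y pre 3 (λ ws → cong not
  (forbidden-invariant B∘τ≡B (ws ++ y ∷ x ∷ []) (ws ++ x ∷ y ∷ []) (patternOf-swapLast ws x y x≢y)))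

oneApart-+ : ∀ k {a b} → OneApart a b → OneApart (k + a) (k + b)
oneApart-+ k (inj₁ e) = inj₁ (trans (cong (k +_) e) (+-suc k _))
oneApart-+ k (inj₂ e) = inj₂ (trans (sym (+-suc k _)) (cong (k +_) e))

count-swapLast₂ : ∀ (p : ℕ → Bool) pre x y → count p (pre ++ y ∷ x ∷ []) ≡ count p (pre ++ x ∷ y ∷ [])
count-swapLast₂ p pre x y =
  trans (count-++ p pre (y ∷ x ∷ []))
    (trans (cong (count p pre +_) (+-exchange (if p y then 1 else 0) (if p x then 1 else 0) 0))
           (sym (count-++ p pre (x ∷ y ∷ []))))

inv-swapLast : ∀ pre x y → x ≢ y → OneApart (inv (pre ++ y ∷ x ∷ [])) (inv (pre ++ x ∷ y ∷ []))
inv-swapLast [] x y x≢y rewrite <ᵇ-flip y x (λ y≡x → x≢y (sym y≡x)) with y <ᵇ x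
... | true  = inj₂ refl
... | false = inj₁ refl
inv-swapLast (w ∷ pre) x y x≢y rewrite count-swapLast₂ (_<ᵇ w) pre x y =
  oneApart-+ (count (_<ᵇ w) (pre ++ x ∷ y ∷ [])) (inv-swapLast pre x y x≢y)

AvBalanced-swapLast : ∀ B → InvariantUnder swapPositions₂₃ B → ∀ n → 2 ≤ n → AvBalanced B n
AvBalanced-swapLast B B∘τ≡B n 2≤n =
  AvBalanced-by-sign-reversal B n swapLast (swapLast-rearranges n n) (λ l _ → swapLast-distinct l)
    same-avoids one-apart
  where
  last-two-distinct : ∀ pre x y → distinct (pre ++ x ∷ y ∷ []) ≡ true → x ≢ y
  last-two-distinct []        x y d = distinct-head {x} {y ∷ []} d (here refl)
  last-two-distinct (w ∷ pre) x y d = last-two-distinct pre x y (distinct-tail {w} {pre ++ x ∷ y ∷ []} d)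
  same-avoids : ∀ l → l ∈ allLists n n → distinct l ≡ true → avoids B (swapLast l) ≡ avoids B l
  same-avoids l l∈ d with shape-last₂ l (allLists-≤-length 2≤n l∈)
  ... | pre , x , y , refl rewrite swapLast-++ pre x y =
    avoids-swapLast B B∘τ≡B pre x y (last-two-distinct pre x y d)
  one-apart : ∀ l → l ∈ allLists n n → distinct l ≡ true → OneApart (inv (swapLast l)) (inv l)
  one-apart l l∈ d with shape-last₂ l (allLists-≤-length 2≤n l∈)
  ... | pre , x , y , refl rewrite swapLast-++ pre x y =
    inv-swapLast pre x y (last-two-distinct pre x y d)

swapAdj : ℕ → ℕ → ℕ
swapAdj u w = if w ≡ᵇ u then suc u else if w ≡ᵇ suc u then u else w

data AdjView (u : ℕ) : ℕ → Set where
  at-u  : AdjView u u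
  at-su : AdjView u (suc u)
  apart : ∀ {w} → w ≢ u → w ≢ suc u → AdjView u w

adjView : ∀ u w → AdjView u w
adjView u w with w ≟ u | w ≟ suc u
... | yes refl | _        = at-u
... | no  _    | yes refl = at-su
... | no  w≢u  | no  w≢su = apart w≢u w≢su

u≡ᵇsu : ∀ u → (u ≡ᵇ suc u) ≡ false
u≡ᵇsu u = ≢⇒≡ᵇ-false u (suc u) (λ e → 1+n≢n (sym e))

su≡ᵇu : ∀ u → (suc u ≡ᵇ u) ≡ false
su≡ᵇu u = ≢⇒≡ᵇ-false (suc u) u 1+n≢n

swapAdj-u : ∀ u → swapAdj u u ≡ suc u
swapAdj-u u rewrite ≡ᵇ-refl u = refl

swapAdj-su : ∀ u → swapAdj u (suc u) ≡ u
swapAdj-su u rewrite su≡ᵇu u | ≡ᵇ-refl u = refl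

swapAdj-apart : ∀ {u w} → w ≢ u → w ≢ suc u → swapAdj u w ≡ w
swapAdj-apart {u} {w} w≢u w≢su rewrite ≢⇒≡ᵇ-false w u w≢u | ≢⇒≡ᵇ-false w (suc u) w≢su = refl

swapAdj-involutive : ∀ u w → swapAdj u (swapAdj u w) ≡ w
swapAdj-involutive u w with adjView u w
... | at-u              rewrite swapAdj-u u  = swapAdj-su u
... | at-su             rewrite swapAdj-su u = swapAdj-u u
... | apart w≢u w≢su    rewrite swapAdj-apart w≢u w≢su = swapAdj-apart w≢u w≢su

swapAdj-injective : ∀ u {a b} → swapAdj u a ≡ swapAdj u b → a ≡ b
swapAdj-injective u {a} {b} e =
  trans (sym (swapAdj-involutive u a)) (trans (cong (swapAdj u) e) (swapAdj-involutive u b))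

swapAdj-distinct : ∀ u l → distinct (map (swapAdj u) l) ≡ distinct l
swapAdj-distinct u []      = refl
swapAdj-distinct u (x ∷ l) = cong₂ (λ a b → not a ∧ b)
  (trans (any-map (swapAdj u x ≡ᵇ_) (swapAdj u) l) (any-cong _ _ l (λ y _ → ≡ᵇ-swapAdj y)))
  (swapAdj-distinct u l)
  where
  ≡ᵇ-swapAdj : ∀ y → (swapAdj u x ≡ᵇ swapAdj u y) ≡ (x ≡ᵇ y)
  ≡ᵇ-swapAdj y = bool-ext
    (λ e → ≡⇒≡ᵇ-true {x} (swapAdj-injective u (≡ᵇ-sound _ _ e)))
    (λ e → ≡⇒≡ᵇ-true {swapAdj u x} (cong (swapAdj u) (≡ᵇ-sound x y e)))

<ᵇ-suc-right : ∀ {u y} → y ≢ u → (y <ᵇ suc u) ≡ (y <ᵇ u)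
<ᵇ-suc-right {u} {y} y≢u = bool-ext
  (λ e → <⇒<ᵇ-true (≤∧≢⇒< (≤-pred (<ᵇ-true⇒< y (suc u) e)) y≢u))
  (λ e → <⇒<ᵇ-true (<-trans (<ᵇ-true⇒< y u e) (n<1+n u)))

<ᵇ-suc-left : ∀ {u x} → x ≢ suc u → (suc u <ᵇ x) ≡ (u <ᵇ x)
<ᵇ-suc-left {u} {x} x≢su = bool-ext
  (λ e → <⇒<ᵇ-true (<-trans (n<1+n u) (<ᵇ-true⇒< (suc u) x e)))
  (λ e → <⇒<ᵇ-true (≤∧≢⇒< (<ᵇ-true⇒< u x e) (λ su≡x → x≢su (sym su≡x))))

-- The pairs {x, y} = {u, suc u} are the only ones whose order swapAdj u reverses.
swapped : ℕ → ℕ → ℕ → Bool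
swapped u x y = ((x ≡ᵇ u) ∧ (y ≡ᵇ suc u)) ∨ ((y ≡ᵇ u) ∧ (x ≡ᵇ suc u))

swapAdj-<ᵇ : ∀ u x y → (swapAdj u x <ᵇ swapAdj u y) ≡ swapped u x y xor (x <ᵇ y)
swapAdj-<ᵇ u x y with adjView u x | adjView u y
... | at-u | at-u rewrite swapAdj-u u | ≡ᵇ-refl u | u≡ᵇsu u = refl
... | at-u | at-su rewrite swapAdj-u u | swapAdj-su u | ≡ᵇ-refl u
                         | ≤⇒<ᵇ-false (n≤1+n u) | <⇒<ᵇ-true (n<1+n u) = refl
... | at-u | apart y≢u y≢su
  rewrite swapAdj-u u | swapAdj-apart y≢u y≢su | ≡ᵇ-refl u | u≡ᵇsu u
        | ≢⇒≡ᵇ-false y u y≢u | ≢⇒≡ᵇ-false y (suc u) y≢su = <ᵇ-suc-left y≢su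
... | at-su | at-u rewrite swapAdj-u u | swapAdj-su u | ≡ᵇ-refl u | su≡ᵇu u
                         | ≤⇒<ᵇ-false (n≤1+n u) | <⇒<ᵇ-true (n<1+n u) = refl
... | at-su | at-su rewrite swapAdj-su u | su≡ᵇu u = refl
... | at-su | apart y≢u y≢su
  rewrite swapAdj-su u | swapAdj-apart y≢u y≢su | su≡ᵇu u | ≡ᵇ-refl u
        | ≢⇒≡ᵇ-false y u y≢u = sym (<ᵇ-suc-left y≢su)
... | apart x≢u x≢su | at-u
  rewrite swapAdj-u u | swapAdj-apart x≢u x≢su | u≡ᵇsu u | ≡ᵇ-refl u
        | ≢⇒≡ᵇ-false x u x≢u | ≢⇒≡ᵇ-false x (suc u) x≢su = <ᵇ-suc-right x≢u
... | apart x≢u x≢su | at-su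
  rewrite swapAdj-su u | swapAdj-apart x≢u x≢su | su≡ᵇu u | ≡ᵇ-refl u
        | ≢⇒≡ᵇ-false x u x≢u = sym (<ᵇ-suc-right x≢u)
... | apart x≢u x≢su | apart y≢u y≢su
  rewrite swapAdj-apart x≢u x≢su | swapAdj-apart y≢u y≢su
        | ≢⇒≡ᵇ-false x u x≢u | ≢⇒≡ᵇ-false y u y≢u = refl

swapped-sym : ∀ u x y → swapped u x y ≡ swapped u y x
swapped-sym u x y = ∨-comm ((x ≡ᵇ u) ∧ (y ≡ᵇ suc u)) ((y ≡ᵇ u) ∧ (x ≡ᵇ suc u))

swapped-true : ∀ u {x y} → swapped u x y ≡ true → (x ≡ u × y ≡ suc u) ⊎ (y ≡ u × x ≡ suc u)
swapped-true u {x} {y} e with ∨-true⁻ {(x ≡ᵇ u) ∧ (y ≡ᵇ suc u)} e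
... | inj₁ e₁ = inj₁ (≡ᵇ-sound x u (∧-conicalˡ _ _ e₁) , ≡ᵇ-sound y (suc u) (∧-conicalʳ (x ≡ᵇ u) _ e₁))
... | inj₂ e₂ = inj₂ (≡ᵇ-sound y u (∧-conicalˡ _ _ e₂) , ≡ᵇ-sound x (suc u) (∧-conicalʳ (y ≡ᵇ u) _ e₂))

swapped⇒partner : ∀ u {x y} → swapped u x y ≡ true → x ≡ swapAdj u y
swapped⇒partner u {x} {y} e with swapped-true u {x} {y} e
... | inj₁ (refl , refl) = sym (swapAdj-su u)
... | inj₂ (refl , refl) = sym (swapAdj-u u)

-- Side true u w: all values are at least u, so u and u + 1 are the two smallest ones and
-- exchanging them acts on patterns as swapValues₁₂; Side false u w: all values are at most
-- u + 1, so they are the two largest ones and the exchange acts as swapValues₂₃.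
Side : Bool → ℕ → ℕ → Set
Side true  u w = u ≤ w
Side false u w = w ≤ suc u

outside-vs-adjacent : ∀ above u {w} → Side above u w → w ≢ u → w ≢ suc u →
  ∀ {v} → v ≡ u ⊎ v ≡ suc u → (v <ᵇ w) ≡ above × (w <ᵇ v) ≡ not above
outside-vs-adjacent true u {w} u≤w w≢u w≢su v∈ =
  <⇒<ᵇ-true (≤-<-trans (v≤su v∈) su<w) , ≤⇒<ᵇ-false (≤-trans (v≤su v∈) (<⇒≤ su<w))
  where
  su<w : suc u < w
  su<w = ≤∧≢⇒< (≤∧≢⇒< u≤w (λ e → w≢u (sym e))) (λ e → w≢su (sym e))
  v≤su : ∀ {v} → v ≡ u ⊎ v ≡ suc u → v ≤ suc u
  v≤su (inj₁ refl) = n≤1+n u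
  v≤su (inj₂ refl) = ≤-refl
outside-vs-adjacent false u {w} w≤su w≢u w≢su v∈ =
  ≤⇒<ᵇ-false (≤-trans (<⇒≤ w<u) (u≤v v∈)) , <⇒<ᵇ-true (<-≤-trans w<u (u≤v v∈))
  where
  w<u : w < u
  w<u = ≤∧≢⇒< (≤-pred (≤∧≢⇒< w≤su w≢su)) w≢u
  u≤v : ∀ {v} → v ≡ u ⊎ v ≡ suc u → u ≤ v
  u≤v (inj₁ refl) = ≤-refl
  u≤v (inj₂ refl) = n≤1+n u

valueSwap : Bool → Pattern → Pattern
valueSwap true  = swapValues₁₂
valueSwap false = swapValues₂₃

orderType-valueSwap-xy : ∀ above a {b c} → b ≡ above → c ≡ above →
  orderType (not a , b , c) ≡ Maybe.map (valueSwap above) (orderType (a , b , c))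
orderType-valueSwap-xy true  true  refl refl = refl
orderType-valueSwap-xy true  false refl refl = refl
orderType-valueSwap-xy false true  refl refl = refl
orderType-valueSwap-xy false false refl refl = refl

orderType-valueSwap-yz : ∀ above b {a c} → a ≡ not above → c ≡ not above →
  orderType (a , not b , c) ≡ Maybe.map (valueSwap above) (orderType (a , b , c))
orderType-valueSwap-yz true  true  refl refl = refl
orderType-valueSwap-yz true  false refl refl = refl
orderType-valueSwap-yz false true  refl refl = refl
orderType-valueSwap-yz false false refl refl = refl

orderType-valueSwap-xz : ∀ above c {a b} → a ≡ above → b ≡ not above →
  orderType (a , b , not c) ≡ Maybe.map (valueSwap above) (orderType (a , b , c))
orderType-valueSwap-xz true  true  refl refl = refl
orderType-valueSwap-xz true  false refl refl = refl
orderType-valueSwap-xz false true  refl refl = refl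
orderType-valueSwap-xz false false refl refl = refl

swapped-vs-outside : ∀ above u {x y w} → swapped u x y ≡ true → w ≢ x → w ≢ y → Side above u w →
  ((x <ᵇ w) ≡ above × (w <ᵇ x) ≡ not above) × ((y <ᵇ w) ≡ above × (w <ᵇ y) ≡ not above)
swapped-vs-outside above u {x} {y} e w≢x w≢y side with swapped-true u {x} {y} e
... | inj₁ (refl , refl) = outside-vs-adjacent above u side w≢x w≢y (inj₁ refl)
                         , outside-vs-adjacent above u side w≢x w≢y (inj₂ refl)
... | inj₂ (refl , refl) = outside-vs-adjacent above u side w≢y w≢x (inj₂ refl)
                         , outside-vs-adjacent above u side w≢y w≢x (inj₁ refl)

patternOf-swapAdj : ∀ above u {t} → DistinctTriple t → (∀ {w} → w ∈ t → Side above u w) →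
  patternOf (map (swapAdj u) t) ≡ patternOf t
  ⊎ patternOf (map (swapAdj u) t) ≡ Maybe.map (valueSwap above) (patternOf t)
patternOf-swapAdj above u {x ∷ y ∷ z ∷ []} (triple x≢y y≢z x≢z) side
  rewrite swapAdj-<ᵇ u x y | swapAdj-<ᵇ u y z | swapAdj-<ᵇ u x z
  with swapped u x y in sxy | swapped u y z in syz | swapped u x z in sxz
... | false | false | false = inj₁ refl
... | true  | false | false =
  let (x<z , _) , (y<z , _) = swapped-vs-outside above u sxy (λ e → x≢z (sym e)) (λ e → y≢z (sym e))
                                                  (side (there (there (here refl))))
  in inj₂ (orderType-valueSwap-xy above (x <ᵇ y) y<z x<z)
... | false | true  | false =
  let (_ , x<y) , (_ , x<z) = swapped-vs-outside above u syz x≢y x≢z (side (here refl))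
  in inj₂ (orderType-valueSwap-yz above (y <ᵇ z) x<y x<z)
... | false | false | true  =
  let (x<y , _) , (_ , y<z) = swapped-vs-outside above u sxz (λ e → x≢y (sym e)) y≢z (side (there (here refl)))
  in inj₂ (orderType-valueSwap-xz above (x <ᵇ z) x<y y<z)
... | true  | true  | _     = ⊥-elim (x≢z (trans (swapped⇒partner u {x} {y} sxy)
                                 (sym (swapped⇒partner u {z} {y} (trans (swapped-sym u z y) syz)))))
... | true  | false | true  = ⊥-elim (y≢z (trans (swapped⇒partner u {y} {x} (trans (swapped-sym u y x) sxy))
                                 (sym (swapped⇒partner u {z} {x} (trans (swapped-sym u z x) sxz)))))
... | false | true  | true  = ⊥-elim (x≢y (trans (swapped⇒partner u {x} {z} sxz)
                                 (sym (swapped⇒partner u {y} {z} syz))))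

avoids-swapAdj : ∀ above u B → InvariantUnder (valueSwap above) B → ∀ l → distinct l ≡ true →
  (∀ {w} → w ∈ l → Side above u w) → avoids B (map (swapAdj u) l) ≡ avoids B l
avoids-swapAdj above u B B∘τ≡B l d side =
  trans (cong (all (λ t → not (forbidden B t))) (choose-map (swapAdj u) 3 l))
    (trans (all-map (λ t → not (forbidden B t)) (map (swapAdj u)) (choose 3 l))
      (all-cong _ _ (choose 3 l) (λ t t∈ → cong not (forbidden-swapAdj t t∈))))
  where
  forbidden-swapAdj : ∀ t → t ∈ choose 3 l → forbidden B (map (swapAdj u) t) ≡ forbidden B t
  forbidden-swapAdj t t∈
    with patternOf-swapAdj above u (distinctTriple (choose-length 3 l t∈) (choose-distinct 3 l d t∈))
           (λ w∈ → side (lookup (choose-⊆ 3 l t∈) w∈))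
  ... | inj₁ same    = cong (maybe′ B false) same
  ... | inj₂ flipped = forbidden-invariant B∘τ≡B (map (swapAdj u) t) t flipped

sumBy-swapAdj : ∀ u (F : ℕ → ℕ) pre post → (∀ {w} → w ∈ pre ++ post → swapAdj u w ≡ w) →
  sumBy (λ x → F (swapAdj u x)) (pre ++ u ∷ suc u ∷ post) ≡ sumBy F (pre ++ u ∷ suc u ∷ post)
sumBy-swapAdj u F pre post fixed =
  trans (sumBy-++ (λ x → F (swapAdj u x)) pre (u ∷ suc u ∷ post))
   (trans (cong₂ _+_ (sumBy-cong _ _ pre (λ w w∈ → cong F (fixed (∈-++⁺ˡ w∈)))) middle)
     (sym (sumBy-++ F pre (u ∷ suc u ∷ post))))
  where
  middle : F (swapAdj u u) + (F (swapAdj u (suc u)) + sumBy (λ x → F (swapAdj u x)) post)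
         ≡ F u + (F (suc u) + sumBy F post)
  middle rewrite swapAdj-u u | swapAdj-su u
               | sumBy-cong (λ x → F (swapAdj u x)) F post (λ w w∈ → cong F (fixed (∈-++⁺ʳ pre w∈))) =
    +-exchange (F (suc u)) (F u) (sumBy F post)

map-rearranges : ∀ (g : ℕ → ℕ) m → (∀ (F : ℕ → ℕ) → sumBy (λ x → F (g x)) (oneTo m) ≡ sumBy F (oneTo m)) →
  ∀ k → Rearranges (map g) (allLists k m)
map-rearranges g m g-permutes zero    p = refl
map-rearranges g m g-permutes (suc k) p =
  trans (count-allLists-suc _ k m)
   (trans (sumBy-cong _ _ (oneTo m) (λ x _ → map-rearranges g m g-permutes k (λ l → p (g x ∷ l))))
     (trans (g-permutes (λ y → count (λ l → p (y ∷ l)) (allLists k m))) (sym (count-allLists-suc p k m))))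

module _ {A : Set} where

  count-xor-disjoint : ∀ (q p : A → Bool) xs → (∀ x → x ∈ xs → q x ≡ true → p x ≡ false) →
    count (λ x → q x xor p x) xs ≡ count q xs + count p xs
  count-xor-disjoint q p []       h = refl
  count-xor-disjoint q p (x ∷ xs) h with q x in qx | p x in px | count-xor-disjoint q p xs (λ y m → h y (there m))
  ... | true  | true  | _  with () ← trans (sym px) (h x (here refl) qx)
  ... | true  | false | ih = cong suc ih
  ... | false | true  | ih = trans (cong suc ih) (sym (+-suc (count q xs) (count p xs)))
  ... | false | false | ih = ih

  count-xor-included : ∀ (q p : A → Bool) xs → (∀ x → x ∈ xs → q x ≡ true → p x ≡ true) →
    count (λ x → q x xor p x) xs + count q xs ≡ count p xs
  count-xor-included q p []       h = refl
  count-xor-included q p (x ∷ xs) h with q x in qx | p x in px | count-xor-included q p xs (λ y m → h y (there m))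
  ... | true  | true  | ih = trans (+-suc _ _) (cong suc ih)
  ... | true  | false | _  with () ← trans (sym px) (h x (here refl) qx)
  ... | false | true  | ih = cong suc ih
  ... | false | false | ih = ih

∈-∷⁻ : ∀ {A : Set} {v x : A} {xs} → v ≢ x → v ∈ x ∷ xs → v ∈ xs
∈-∷⁻ v≢x (here v≡x) = ⊥-elim (v≢x v≡x)
∈-∷⁻ v≢x (there v∈) = v∈

count-≡ᵇ-unique : ∀ {v} xs → distinct xs ≡ true → v ∈ xs → count (_≡ᵇ v) xs ≡ 1
count-≡ᵇ-unique {v} (x ∷ xs) d (here refl) rewrite ≡ᵇ-refl v =
  cong suc (count-none _ xs (λ y y∈ → ≢⇒≡ᵇ-false y v (λ y≡v → distinct-head {v} {xs} d y∈ (sym y≡v))))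
count-≡ᵇ-unique {v} (x ∷ xs) d (there v∈) rewrite ≢⇒≡ᵇ-false x v (distinct-head {x} {xs} d v∈) =
  count-≡ᵇ-unique xs (distinct-tail {x} {xs} d) v∈

inv-map : ∀ (g : ℕ → ℕ) x xs → inv (map g (x ∷ xs)) ≡ count (λ y → g y <ᵇ g x) xs + inv (map g xs)
inv-map g x xs = cong (_+ inv (map g xs)) (count-map (_<ᵇ g x) g xs)

inv-swapAdj-absent : ∀ u l → distinct l ≡ true → ¬ (u ∈ l × suc u ∈ l) → inv (map (swapAdj u) l) ≡ inv l
inv-swapAdj-absent u []       d absent = refl
inv-swapAdj-absent u (x ∷ xs) d absent =
  trans (inv-map (swapAdj u) x xs)
    (cong₂ _+_ (count-cong _ _ xs unswapped)
               (inv-swapAdj-absent u xs (distinct-tail {x} {xs} d) (λ (u∈ , su∈) → absent (there u∈ , there su∈))))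
  where
  unswapped : ∀ y → y ∈ xs → (swapAdj u y <ᵇ swapAdj u x) ≡ (y <ᵇ x)
  unswapped y y∈ rewrite swapAdj-<ᵇ u y x with swapped u y x in s
  ... | false = refl
  ... | true with swapped-true u {y} {x} s
  ...   | inj₁ (refl , refl) = ⊥-elim (absent (there y∈ , here refl))
  ...   | inj₂ (refl , refl) = ⊥-elim (absent (here refl , there y∈))

swapped-at-u : ∀ u y → swapped u y u ≡ (y ≡ᵇ suc u)
swapped-at-u u y rewrite u≡ᵇsu u | ≡ᵇ-refl u | ∧-zeroʳ (y ≡ᵇ u) = refl

swapped-at-su : ∀ u y → swapped u y (suc u) ≡ (y ≡ᵇ u)
swapped-at-su u y rewrite ≡ᵇ-refl u | su≡ᵇu u = trans (∨-identityʳ _) (∧-identityʳ (y ≡ᵇ u))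

swapped-apart : ∀ u {x} → x ≢ u → x ≢ suc u → ∀ y → swapped u y x ≡ false
swapped-apart u {x} x≢u x≢su y rewrite ≢⇒≡ᵇ-false x u x≢u | ≢⇒≡ᵇ-false x (suc u) x≢su
  = trans (cong (_∨ false) (∧-zeroʳ (y ≡ᵇ u))) refl

inv-swapAdj-present : ∀ u l → distinct l ≡ true → u ∈ l → suc u ∈ l → OneApart (inv (map (swapAdj u) l)) (inv l)
inv-swapAdj-present u (x ∷ xs) d u∈ su∈ with adjView u x
... | at-u = inj₁ (begin
      inv (map g (u ∷ xs))                          ≡⟨ inv-map g u xs ⟩
      count (λ y → g y <ᵇ g u) xs + inv (map g xs)
        ≡⟨ cong₂ _+_ raised (inv-swapAdj-absent u xs d′ (λ (u∈xs , _) → u∉xs u∈xs)) ⟩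
      suc (count (_<ᵇ u) xs) + inv xs                ∎)
  where
  open ≡-Reasoning
  g = swapAdj u
  d′ = distinct-tail {u} {xs} d
  u∉xs : ¬ (u ∈ xs)
  u∉xs u∈xs = distinct-head {u} {xs} d u∈xs refl
  su∈xs : suc u ∈ xs
  su∈xs = ∈-∷⁻ 1+n≢n su∈
  above : ∀ y → y ∈ xs → (y ≡ᵇ suc u) ≡ true → (y <ᵇ u) ≡ false
  above y _ y≡su = subst (λ w → (w <ᵇ u) ≡ false) (sym (≡ᵇ-sound y (suc u) y≡su)) (≤⇒<ᵇ-false (n≤1+n u))
  raised : count (λ y → g y <ᵇ g u) xs ≡ suc (count (_<ᵇ u) xs)
  raised = begin
    count (λ y → g y <ᵇ g u) xs
      ≡⟨ count-cong _ _ xs (λ y _ → trans (swapAdj-<ᵇ u y u) (cong (_xor (y <ᵇ u)) (swapped-at-u u y))) ⟩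
    count (λ y → (y ≡ᵇ suc u) xor (y <ᵇ u)) xs
      ≡⟨ count-xor-disjoint _ _ xs above ⟩
    count (_≡ᵇ suc u) xs + count (_<ᵇ u) xs
      ≡⟨ cong (_+ count (_<ᵇ u) xs) (count-≡ᵇ-unique xs d′ su∈xs) ⟩
    suc (count (_<ᵇ u) xs) ∎
... | at-su = inj₂ (begin
      suc (inv (map g (suc u ∷ xs)))                        ≡⟨ cong suc (inv-map g (suc u) xs) ⟩
      suc (count (λ y → g y <ᵇ g (suc u)) xs + inv (map g xs))
        ≡⟨ cong suc (cong₂ _+_ (count-cong _ _ xs (λ y _ → trans (swapAdj-<ᵇ u y (suc u))
                                  (cong (_xor (y <ᵇ suc u)) (swapped-at-su u y))))
                               (inv-swapAdj-absent u xs d′ (λ (_ , su∈xs) → su∉xs su∈xs))) ⟩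
      suc (X + inv xs)                                       ≡⟨ cong (_+ inv xs) (+-comm 1 X) ⟩
      X + 1 + inv xs
        ≡⟨ cong (λ c → X + c + inv xs) (sym (count-≡ᵇ-unique xs d′ u∈xs)) ⟩
      X + count (_≡ᵇ u) xs + inv xs                          ≡⟨ cong (_+ inv xs) (count-xor-included _ _ xs below) ⟩
      count (_<ᵇ suc u) xs + inv xs                          ∎)
  where
  open ≡-Reasoning
  g = swapAdj u
  d′ = distinct-tail {suc u} {xs} d
  su∉xs : ¬ (suc u ∈ xs)
  su∉xs su∈xs = distinct-head {suc u} {xs} d su∈xs refl
  u∈xs : u ∈ xs
  u∈xs = ∈-∷⁻ (λ u≡su → 1+n≢n (sym u≡su)) u∈
  X = count (λ y → (y ≡ᵇ u) xor (y <ᵇ suc u)) xs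
  below : ∀ y → y ∈ xs → (y ≡ᵇ u) ≡ true → (y <ᵇ suc u) ≡ true
  below y _ y≡u = subst (λ w → (w <ᵇ suc u) ≡ true) (sym (≡ᵇ-sound y u y≡u)) (<⇒<ᵇ-true (n<1+n u))
... | apart x≢u x≢su =
  subst (λ i → OneApart i (inv (x ∷ xs))) (sym same-count)
        (oneApart-+ (count (_<ᵇ x) xs)
          (inv-swapAdj-present u xs (distinct-tail {x} {xs} d) (∈-∷⁻ (λ u≡x → x≢u (sym u≡x)) u∈)
                                                               (∈-∷⁻ (λ su≡x → x≢su (sym su≡x)) su∈)))
  where
  same-count : inv (map (swapAdj u) (x ∷ xs)) ≡ count (_<ᵇ x) xs + inv (map (swapAdj u) xs)
  same-count = trans (inv-map (swapAdj u) x xs) (cong (_+ _) (count-cong _ _ xs (λ y _ →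
    trans (swapAdj-<ᵇ u y x) (cong (_xor (y <ᵇ x)) (swapped-apart u x≢u x≢su y)))))

distinct-length-< : ∀ l S {v} → distinct l ≡ true → (∀ {y} → y ∈ l → y ∈ S) → v ∈ S → ¬ (v ∈ l) →
  length l < length S
distinct-length-< []      (_ ∷ _) d l⊆S v∈S v∉l = s≤s z≤n
distinct-length-< (x ∷ l) S       d l⊆S v∈S v∉l with ∈-∃++ (l⊆S (here refl))
... | S₁ , S₂ , refl = subst (length (x ∷ l) <_) (sym length-S) (s≤s shorter)
  where
  length-S : length (S₁ ++ x ∷ S₂) ≡ suc (length (S₁ ++ S₂))
  length-S rewrite length-++ S₁ {x ∷ S₂} | length-++ S₁ {S₂} = +-suc (length S₁) (length S₂)
  remove : ∀ {y} → y ≢ x → y ∈ S₁ ++ x ∷ S₂ → y ∈ S₁ ++ S₂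
  remove y≢x y∈ with ∈-++⁻ S₁ y∈
  ... | inj₁ y∈S₁        = ∈-++⁺ˡ y∈S₁
  ... | inj₂ y∈x∷S₂      = ∈-++⁺ʳ S₁ (∈-∷⁻ y≢x y∈x∷S₂)
  shorter : length l < length (S₁ ++ S₂)
  shorter = distinct-length-< l (S₁ ++ S₂) (distinct-tail {x} {l} d)
    (λ y∈l → remove (λ y≡x → distinct-head {x} {l} d y∈l (sym y≡x)) (l⊆S (there y∈l)))
    (remove (λ v≡x → v∉l (here v≡x)) v∈S) (λ v∈l → v∉l (there v∈l))

length-oneTo : ∀ m → length (oneTo m) ≡ m
length-oneTo m = trans (length-map suc (upTo m)) (length-upTo m)

allLists-complete : ∀ n {l v} → l ∈ allLists n n → distinct l ≡ true → v ∈ oneTo n → v ∈ l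
allLists-complete n {l} {v} l∈ d v∈ with v ∈? l
... | yes v∈l = v∈l
... | no  v∉l = ⊥-elim (<-irrefl (trans (allLists-length n n l∈) (sym (length-oneTo n)))
                          (distinct-length-< l (oneTo n) d (allLists-entries n n l∈) v∈ v∉l))

AvBalanced-swapAdj : ∀ above u n B → InvariantUnder (valueSwap above) B →
  u ∈ oneTo n → suc u ∈ oneTo n → (∀ {w} → w ∈ oneTo n → Side above u w) →
  (∀ (F : ℕ → ℕ) → sumBy (λ x → F (swapAdj u x)) (oneTo n) ≡ sumBy F (oneTo n)) →
  AvBalanced B n
AvBalanced-swapAdj above u n B B∘τ≡B u∈ su∈ side permutes =
  AvBalanced-by-sign-reversal B n (map (swapAdj u)) (map-rearranges (swapAdj u) n permutes n)
    (λ l _ → swapAdj-distinct u l)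
    (λ l l∈ d → avoids-swapAdj above u B B∘τ≡B l d (λ w∈ → side (allLists-entries n n l∈ w∈)))
    (λ l l∈ d → inv-swapAdj-present u l d (allLists-complete n l∈ d u∈) (allLists-complete n l∈ d su∈))

∈-oneTo⁻ : ∀ {m w} → w ∈ oneTo m → ∃ λ i → i < m × w ≡ suc i
∈-oneTo⁻ w∈ with ∈-map⁻ suc w∈
... | i , i∈ , refl = i , ∈-upTo⁻ i∈ , refl

∈-oneTo⁺ : ∀ {m i} → i < m → suc i ∈ oneTo m
∈-oneTo⁺ i<m = ∈-map⁺ suc (∈-upTo⁺ i<m)

AvBalanced-swapBottom : ∀ B → InvariantUnder swapValues₁₂ B → ∀ n → 2 ≤ n → AvBalanced B n
AvBalanced-swapBottom B B∘τ≡B (suc zero) (s≤s ())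
AvBalanced-swapBottom B B∘τ≡B (suc (suc k)) _ =
  AvBalanced-swapAdj true 1 (suc (suc k)) B B∘τ≡B (here refl) (there (here refl)) positive
    (λ F → sumBy-swapAdj 1 F [] _ fixed)
  where
  positive : ∀ {w} → w ∈ oneTo (suc (suc k)) → 1 ≤ w
  positive w∈ with ∈-oneTo⁻ {suc (suc k)} w∈
  ... | i , _ , refl = s≤s z≤n
  fixed : ∀ {w} → w ∈ map suc (applyUpTo (λ i → suc (suc i)) k) → swapAdj 1 w ≡ w
  fixed w∈ with ∈-map⁻ suc w∈
  ... | v , v∈ , refl with ∈-applyUpTo⁻ (λ i → suc (suc i)) v∈
  ... | i , _ , refl = refl

oneTo-∷ʳ₂ : ∀ k → oneTo (suc (suc k)) ≡ oneTo k ++ suc k ∷ suc (suc k) ∷ []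
oneTo-∷ʳ₂ k =
  trans (cong (map suc) (sym (trans (cong (_++ (suc k ∷ [])) (upTo-∷ʳ k)) (upTo-∷ʳ (suc k)))))
  (trans (map-++ suc (upTo k ++ k ∷ []) (suc k ∷ []))
  (trans (cong (_++ (suc (suc k) ∷ [])) (map-++ suc (upTo k) (k ∷ [])))
         (++-assoc (oneTo k) (suc k ∷ []) (suc (suc k) ∷ []))))

AvBalanced-swapTop : ∀ B → InvariantUnder swapValues₂₃ B → ∀ n → 2 ≤ n → AvBalanced B n
AvBalanced-swapTop B B∘τ≡B (suc zero) (s≤s ())
AvBalanced-swapTop B B∘τ≡B (suc (suc k)) _ =
  AvBalanced-swapAdj false (suc k) (suc (suc k)) B B∘τ≡B
    (∈-oneTo⁺ (n≤1+n (suc k))) (∈-oneTo⁺ (n<1+n (suc k))) bounded permutes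
  where
  bounded : ∀ {w} → w ∈ oneTo (suc (suc k)) → w ≤ suc (suc k)
  bounded w∈ with ∈-oneTo⁻ {suc (suc k)} w∈
  ... | i , i<n , refl = i<n
  fixed : ∀ {w} → w ∈ oneTo k ++ [] → swapAdj (suc k) w ≡ w
  fixed w∈ with ∈-oneTo⁻ {k} (subst (_ ∈_) (++-identityʳ (oneTo k)) w∈)
  ... | i , i<k , refl = swapAdj-apart (λ e → <-irrefl (suc-injective e) i<k)
                                       (λ e → <-irrefl (suc-injective e) (<-trans i<k (n<1+n k)))
  permutes : ∀ (F : ℕ → ℕ) → sumBy (λ x → F (swapAdj (suc k) x)) (oneTo (suc (suc k))) ≡ sumBy F (oneTo (suc (suc k)))
  permutes F = subst (λ L → sumBy (λ x → F (swapAdj (suc k) x)) L ≡ sumBy F L) (sym (oneTo-∷ʳ₂ k))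
                     (sumBy-swapAdj (suc k) F (oneTo k) [] fixed)

-- Erdős–Szekeres for five entries

Monotone : List ℕ → Set
Monotone t = patternOf t ≡ just p123 ⊎ patternOf t ≡ just p321

HasMonotone : List ℕ → Set
HasMonotone l = ∃ λ t → t ⊆ l × Monotone t

increasing : ∀ {x y z} → x < y → y < z → Monotone (x ∷ y ∷ z ∷ [])
increasing x<y y<z rewrite <⇒<ᵇ-true x<y | <⇒<ᵇ-true y<z | <⇒<ᵇ-true (<-trans x<y y<z) = inj₁ refl

decreasing : ∀ {x y z} → y < x → z < y → Monotone (x ∷ y ∷ z ∷ [])
decreasing y<x z<y rewrite ≤⇒<ᵇ-false (<⇒≤ y<x) | ≤⇒<ᵇ-false (<⇒≤ z<y) | ≤⇒<ᵇ-false (<⇒≤ (<-trans z<y y<x)) =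
  inj₂ refl

module _ {a : ℕ} {l : List ℕ} where

  three-above : ∀ {p q r} → a < p → a < q → p ≢ q → q ≢ r →
    (a ∷ p ∷ q ∷ []) ⊆ l → (a ∷ q ∷ r ∷ []) ⊆ l → (p ∷ q ∷ r ∷ []) ⊆ l → HasMonotone l
  three-above {p} {q} {r} a<p a<q p≢q q≢r apq aqr pqr with cmp p q p≢q
  ... | lt p<q = _ , apq , increasing a<p p<q
  ... | gt q<p with cmp q r q≢r
  ...   | lt q<r = _ , aqr , increasing a<q q<r
  ...   | gt r<q = _ , pqr , decreasing q<p r<q

  three-below : ∀ {p q r} → p < a → q < a → p ≢ q → q ≢ r →
    (a ∷ p ∷ q ∷ []) ⊆ l → (a ∷ q ∷ r ∷ []) ⊆ l → (p ∷ q ∷ r ∷ []) ⊆ l → HasMonotone l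
  three-below {p} {q} {r} p<a q<a p≢q q≢r apq aqr pqr with cmp p q p≢q
  ... | gt q<p = _ , apq , decreasing p<a q<p
  ... | lt p<q with cmp q r q≢r
  ...   | gt r<q = _ , aqr , decreasing q<a r<q
  ...   | lt q<r = _ , pqr , increasing p<q q<r

  -- u₁ u₂ lie above a and l₁ l₂ below it, each pair in order of position; which of the two
  -- lemmas applies depends on whether l₂ comes after u₂.
  two-above-two-below : ∀ {u₁ u₂ l₁ l₂} → a < u₁ → a < u₂ → l₁ < a → l₂ < a → u₁ ≢ u₂ → l₁ ≢ l₂ →
    (a ∷ u₁ ∷ u₂ ∷ []) ⊆ l → (a ∷ l₁ ∷ l₂ ∷ []) ⊆ l → (u₁ ∷ u₂ ∷ l₂ ∷ []) ⊆ l → HasMonotone l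
  two-above-two-below {u₁} {u₂} {l₁} {l₂} a<u₁ a<u₂ l₁<a l₂<a u₁≢u₂ l₁≢l₂ auu all uul with cmp u₁ u₂ u₁≢u₂
  ... | lt u₁<u₂ = _ , auu , increasing a<u₁ u₁<u₂
  ... | gt u₂<u₁ with cmp l₁ l₂ l₁≢l₂
  ...   | gt l₂<l₁ = _ , all , decreasing l₁<a l₂<l₁
  ...   | lt _     = _ , uul , decreasing u₂<u₁ (<-trans l₂<a a<u₂)

  two-below-two-above : ∀ {u₁ u₂ l₁ l₂} → a < u₁ → a < u₂ → l₁ < a → l₂ < a → u₁ ≢ u₂ → l₁ ≢ l₂ →
    (a ∷ u₁ ∷ u₂ ∷ []) ⊆ l → (a ∷ l₁ ∷ l₂ ∷ []) ⊆ l → (l₁ ∷ l₂ ∷ u₂ ∷ []) ⊆ l → HasMonotone l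
  two-below-two-above {u₁} {u₂} {l₁} {l₂} a<u₁ a<u₂ l₁<a l₂<a u₁≢u₂ l₁≢l₂ auu all llu with cmp u₁ u₂ u₁≢u₂
  ... | lt u₁<u₂ = _ , auu , increasing a<u₁ u₁<u₂
  ... | gt u₂<u₁ with cmp l₁ l₂ l₁≢l₂
  ...   | gt l₂<l₁ = _ , all , decreasing l₁<a l₂<l₁
  ...   | lt l₁<l₂ = _ , llu , increasing l₁<l₂ (<-trans l₂<a a<u₂)

erdős-szekeres₅ : ∀ a b c d e → distinct (a ∷ b ∷ c ∷ d ∷ e ∷ []) ≡ true → HasMonotone (a ∷ b ∷ c ∷ d ∷ e ∷ [])
erdős-szekeres₅ a b c d e dist =
  by-sides (cmp a b (a≢ (here refl))) (cmp a c (a≢ (there (here refl))))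
           (cmp a d (a≢ (there (there (here refl))))) (cmp a e (a≢ (there (there (there (here refl))))))
  where
  dist₁ = distinct-tail {a} {b ∷ c ∷ d ∷ e ∷ []} dist
  dist₂ = distinct-tail {b} {c ∷ d ∷ e ∷ []} dist₁
  a≢ : ∀ {x} → x ∈ b ∷ c ∷ d ∷ e ∷ [] → a ≢ x
  a≢ = distinct-head {a} {b ∷ c ∷ d ∷ e ∷ []} dist
  b≢ : ∀ {x} → x ∈ c ∷ d ∷ e ∷ [] → b ≢ x
  b≢ = distinct-head {b} {c ∷ d ∷ e ∷ []} dist₁
  c≢ : ∀ {x} → x ∈ d ∷ e ∷ [] → c ≢ x
  c≢ = distinct-head {c} {d ∷ e ∷ []} dist₂
  b≢c = b≢ (here refl)
  b≢d = b≢ (there (here refl))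
  b≢e = b≢ (there (there (here refl)))
  c≢d = c≢ (here refl)
  c≢e = c≢ (there (here refl))
  d≢e : d ≢ e
  d≢e = distinct-head {d} {e ∷ []} (distinct-tail {c} {d ∷ e ∷ []} dist₂) (here refl)
  s123 = refl ∷ refl ∷ refl ∷ d ∷ʳ e ∷ʳ []
  s124 = refl ∷ refl ∷ c ∷ʳ refl ∷ e ∷ʳ []
  s125 = refl ∷ refl ∷ c ∷ʳ d ∷ʳ refl ∷ []
  s134 = refl ∷ b ∷ʳ refl ∷ refl ∷ e ∷ʳ []
  s135 = refl ∷ b ∷ʳ refl ∷ d ∷ʳ refl ∷ []
  s145 = refl ∷ b ∷ʳ c ∷ʳ refl ∷ refl ∷ []
  s234 = a ∷ʳ refl ∷ refl ∷ refl ∷ e ∷ʳ []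
  s235 = a ∷ʳ refl ∷ refl ∷ d ∷ʳ refl ∷ []
  s245 = a ∷ʳ refl ∷ c ∷ʳ refl ∷ refl ∷ []
  s345 = a ∷ʳ b ∷ʳ refl ∷ refl ∷ refl ∷ []
  by-sides : Cmp a b → Cmp a c → Cmp a d → Cmp a e → HasMonotone (a ∷ b ∷ c ∷ d ∷ e ∷ [])
  by-sides (lt ab) (lt ac) (lt ad) (lt ae) = three-above ab ac b≢c c≢d s123 s134 s234
  by-sides (lt ab) (lt ac) (lt ad) (gt ea) = three-above ab ac b≢c c≢d s123 s134 s234
  by-sides (lt ab) (lt ac) (gt da) (lt ae) = three-above ab ac b≢c c≢e s123 s135 s235
  by-sides (lt ab) (lt ac) (gt da) (gt ea) = two-above-two-below ab ac da ea b≢c d≢e s123 s145 s235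
  by-sides (lt ab) (gt ca) (lt ad) (lt ae) = three-above ab ad b≢d d≢e s124 s145 s245
  by-sides (lt ab) (gt ca) (lt ad) (gt ea) = two-above-two-below ab ad ca ea b≢d c≢e s124 s135 s245
  by-sides (lt ab) (gt ca) (gt da) (lt ae) = two-below-two-above ab ae ca da b≢e c≢d s125 s134 s345
  by-sides (lt ab) (gt ca) (gt da) (gt ea) = three-below ca da c≢d d≢e s134 s145 s345
  by-sides (gt ba) (lt ac) (lt ad) (lt ae) = three-above ac ad c≢d d≢e s134 s145 s345
  by-sides (gt ba) (lt ac) (lt ad) (gt ea) = two-above-two-below ac ad ba ea c≢d b≢e s134 s125 s345
  by-sides (gt ba) (lt ac) (gt da) (lt ae) = two-below-two-above ac ae ba da c≢e b≢d s135 s124 s245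
  by-sides (gt ba) (lt ac) (gt da) (gt ea) = three-below ba da b≢d d≢e s124 s145 s245
  by-sides (gt ba) (gt ca) (lt ad) (lt ae) = two-below-two-above ad ae ba ca d≢e b≢c s145 s123 s235
  by-sides (gt ba) (gt ca) (lt ad) (gt ea) = three-below ba ca b≢c c≢e s123 s135 s235
  by-sides (gt ba) (gt ca) (gt da) (lt ae) = three-below ba ca b≢c c≢d s123 s134 s234
  by-sides (gt ba) (gt ca) (gt da) (gt ea) = three-below ba ca b≢c c≢d s123 s134 s234

⊆⇒∈-choose : ∀ {t l : List ℕ} → t ⊆ l → t ∈ choose (length t) l
⊆⇒∈-choose []                       = here refl
⊆⇒∈-choose {[]}    (_ ∷ʳ _)         = here refl
⊆⇒∈-choose {x ∷ t} {y ∷ l} (_ ∷ʳ t⊆l) = ∈-++⁺ʳ (map (y ∷_) (choose (length t) l)) (⊆⇒∈-choose t⊆l)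
⊆⇒∈-choose {x ∷ t} (refl ∷ t⊆l)     = ∈-++⁺ˡ (∈-map⁺ (x ∷_) (⊆⇒∈-choose t⊆l))

patternOf-just⇒length : ∀ t {ρ} → patternOf t ≡ just ρ → length t ≡ 3
patternOf-just⇒length (x ∷ y ∷ z ∷ [])    _  = refl
patternOf-just⇒length []                  ()
patternOf-just⇒length (x ∷ [])            ()
patternOf-just⇒length (x ∷ y ∷ [])        ()
patternOf-just⇒length (x ∷ y ∷ z ∷ w ∷ t) ()

prefix₅ : ∀ (a b c d e : ℕ) r → (a ∷ b ∷ c ∷ d ∷ e ∷ []) ⊆ (a ∷ b ∷ c ∷ d ∷ e ∷ r)
prefix₅ a b c d e r = refl ∷ refl ∷ refl ∷ refl ∷ refl ∷ minimum r

monotone⇒¬avoids : ∀ B → B p123 ≡ true → B p321 ≡ true → ∀ {t l} → t ⊆ l → Monotone t → avoids B l ≡ false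
monotone⇒¬avoids B B123 B321 {t} {l} t⊆l mono =
  all-false⁺ (λ s → not (forbidden B s))
    (subst (λ k → t ∈ choose k l) (patternOf-just⇒length t (proj₂ (proj₂ (witness mono)))) (⊆⇒∈-choose t⊆l))
    (cong not (trans (cong (maybe′ B false) (proj₂ (proj₂ (witness mono)))) (proj₁ (proj₂ (witness mono)))))
  where
  witness : Monotone t → ∃ λ ρ → B ρ ≡ true × patternOf t ≡ just ρ
  witness (inj₁ is123) = p123 , B123 , is123
  witness (inj₂ is321) = p321 , B321 , is321

avoids-123-321 : ∀ B → B p123 ≡ true → B p321 ≡ true →
  ∀ l → 5 ≤ length l → distinct l ≡ true → avoids B l ≡ false
avoids-123-321 B B123 B321 (a ∷ b ∷ c ∷ d ∷ e ∷ r) _ dist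
  with erdős-szekeres₅ a b c d e (⊆-distinct (prefix₅ a b c d e r) dist)
... | t , t⊆ , mono = monotone⇒¬avoids B B123 B321 (⊆-trans t⊆ (prefix₅ a b c d e r)) mono
avoids-123-321 B B123 B321 []                   ()                                _
avoids-123-321 B B123 B321 (_ ∷ [])             (s≤s ())                          _
avoids-123-321 B B123 B321 (_ ∷ _ ∷ [])         (s≤s (s≤s ()))                    _
avoids-123-321 B B123 B321 (_ ∷ _ ∷ _ ∷ [])     (s≤s (s≤s (s≤s ())))              _
avoids-123-321 B B123 B321 (_ ∷ _ ∷ _ ∷ _ ∷ []) (s≤s (s≤s (s≤s (s≤s ()))))        _

AvBalanced-123-321 : ∀ B → B p123 ≡ true → B p321 ≡ true → ∀ n → 5 ≤ n → AvBalanced B n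
AvBalanced-123-321 B B123 B321 n 5≤n = trans (empty isEven) (sym (empty isOdd))
  where
  empty : ∀ p → countAv B p n ≡ 0
  empty p = count-none _ (allLists n n) excluded
    where
    excluded : ∀ l → l ∈ allLists n n → inAv B l ∧ p l ≡ false
    excluded l l∈ with distinct l in d
    ... | false = refl
    ... | true rewrite avoids-123-321 B B123 B321 l (allLists-≤-length 5≤n l∈) d = refl

-- Deciding the 64 pattern sets

AlwaysBalanced : (Pattern → Bool) → Set
AlwaysBalanced B = ∀ n → 1 < n → AvBalanced B n

specialSet : Pattern → Bool
specialSet p123 = false
specialSet p132 = true
specialSet p213 = true
specialSet p231 = true
specialSet p312 = true
specialSet p321 = false

countPatterns : (Pattern → Bool) → (List ℕ → Bool) → ℕ
countPatterns B p = count (λ ρ → B ρ ∧ p (oneLine ρ)) patterns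

Criterion : (Pattern → Bool) → Set
Criterion B = ¬ (∀ ρ → B ρ ≡ specialSet ρ) × countPatterns B isEven ≡ countPatterns B isOdd

AlwaysBalanced-123-321 : ∀ B → B p123 ≡ true → B p321 ≡ true →
  AvBalanced B 2 → AvBalanced B 3 → AvBalanced B 4 → AlwaysBalanced B
AlwaysBalanced-123-321 B B123 B321 bal₂ bal₃ bal₄ 1 (s≤s ())
AlwaysBalanced-123-321 B B123 B321 bal₂ bal₃ bal₄ 2 _ = bal₂
AlwaysBalanced-123-321 B B123 B321 bal₂ bal₃ bal₄ 3 _ = bal₃
AlwaysBalanced-123-321 B B123 B321 bal₂ bal₃ bal₄ 4 _ = bal₄
AlwaysBalanced-123-321 B B123 B321 bal₂ bal₃ bal₄ (suc (suc (suc (suc (suc n))))) _ =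
  AvBalanced-123-321 B B123 B321 (5 + n) (s≤s (s≤s (s≤s (s≤s (s≤s z≤n)))))

invariantᵇ : (Pattern → Pattern) → (Pattern → Bool) → Bool
invariantᵇ τ B = all (λ ρ → B (τ ρ) == B ρ) patterns

invariantᵇ-sound : ∀ τ B → invariantᵇ τ B ≡ true → InvariantUnder τ B
invariantᵇ-sound τ B e ρ = ==-sound (all-true⁻ (λ ρ → B (τ ρ) == B ρ) patterns e (∈-patterns ρ))

balancedAtᵇ : (Pattern → Bool) → ℕ → Bool
balancedAtᵇ B n = countAv B isEven n ≡ᵇ countAv B isOdd n

balancedAtᵇ-true : ∀ B n → balancedAtᵇ B n ≡ true → AvBalanced B n
balancedAtᵇ-true B n = ≡ᵇ-sound _ _

balancedAtᵇ-false : ∀ B n → balancedAtᵇ B n ≡ false → ¬ AvBalanced B n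
balancedAtᵇ-false B n e bal with () ← trans (sym e) (≡⇒≡ᵇ-true {countAv B isEven n} bal)

balancedCertificate : (Pattern → Bool) → Bool
balancedCertificate B =
  invariantᵇ swapPositions₁₂ B ∨ invariantᵇ swapPositions₂₃ B ∨
  invariantᵇ swapValues₁₂ B ∨ invariantᵇ swapValues₂₃ B ∨
  (B p123 ∧ B p321 ∧ balancedAtᵇ B 2 ∧ balancedAtᵇ B 3 ∧ balancedAtᵇ B 4)

balancedCertificate-sound : ∀ B → balancedCertificate B ≡ true → AlwaysBalanced B
balancedCertificate-sound B e with ∨-true⁻ {invariantᵇ swapPositions₁₂ B} e
... | inj₁ e₁ = AvBalanced-swapFront B (invariantᵇ-sound _ B e₁)
... | inj₂ e with ∨-true⁻ {invariantᵇ swapPositions₂₃ B} e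
... | inj₁ e₂ = AvBalanced-swapLast B (invariantᵇ-sound _ B e₂)
... | inj₂ e with ∨-true⁻ {invariantᵇ swapValues₁₂ B} e
... | inj₁ e₃ = AvBalanced-swapBottom B (invariantᵇ-sound _ B e₃)
... | inj₂ e with ∨-true⁻ {invariantᵇ swapValues₂₃ B} e
... | inj₁ e₄ = AvBalanced-swapTop B (invariantᵇ-sound _ B e₄)
... | inj₂ e with ∧-true⁻ {B p123} e
... | B123 , e with ∧-true⁻ {B p321} e
... | B321 , e with ∧-true⁻ {balancedAtᵇ B 2} e
... | b₂ , e with ∧-true⁻ {balancedAtᵇ B 3} e
... | b₃ , b₄ =
  AlwaysBalanced-123-321 B B123 B321 (balancedAtᵇ-true B 2 b₂) (balancedAtᵇ-true B 3 b₃) (balancedAtᵇ-true B 4 b₄)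

unbalancedCertificate : (Pattern → Bool) → Bool
unbalancedCertificate B = not (balancedAtᵇ B 3) ∨ not (balancedAtᵇ B 4)

unbalancedCertificate-sound : ∀ B → unbalancedCertificate B ≡ true → ¬ AlwaysBalanced B
unbalancedCertificate-sound B e bal with ∨-true⁻ {not (balancedAtᵇ B 3)} e
... | inj₁ e₃ = balancedAtᵇ-false B 3 (not-injective e₃) (bal 3 (s≤s (s≤s z≤n)))
... | inj₂ e₄ = balancedAtᵇ-false B 4 (not-injective e₄) (bal 4 (s≤s (s≤s z≤n)))

criterionᵇ : (Pattern → Bool) → Bool
criterionᵇ B =
  not (all (λ ρ → B ρ == specialSet ρ) patterns) ∧ (countPatterns B isEven ≡ᵇ countPatterns B isOdd)

criterionᵇ-reflects : ∀ B → criterionᵇ B ≡ true ⇔ Criterion B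
criterionᵇ-reflects B = mk⇔ to from
  where
  agrees = λ ρ → B ρ == specialSet ρ
  all-agree⇔ : all agrees patterns ≡ true ⇔ (∀ ρ → B ρ ≡ specialSet ρ)
  all-agree⇔ = mk⇔ (λ e ρ → ==-sound (all-true⁻ agrees patterns e (∈-patterns ρ)))
                   (λ isSpecial → all-true⁺ agrees patterns (λ ρ _ → ==-complete (isSpecial ρ)))
  to : criterionᵇ B ≡ true → Criterion B
  to e with ∧-true⁻ {not (all agrees patterns)} e
  ... | notAll , parity =
    (λ isSpecial → false≢true (trans (sym (not-injective notAll)) (Equivalence.from all-agree⇔ isSpecial)))
    , ≡ᵇ-sound _ _ parity
  from : Criterion B → criterionᵇ B ≡ true
  from (notSpecial , parity) with all agrees patterns in e
  ... | true  = ⊥-elim (notSpecial (Equivalence.to all-agree⇔ e))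
  ... | false = ≡⇒≡ᵇ-true {countPatterns B isEven} parity

certified : (Pattern → Bool) → Bool
certified B = if criterionᵇ B then balancedCertificate B else unbalancedCertificate B

certified⇒balanced⇔criterion : ∀ B → certified B ≡ true → AlwaysBalanced B ⇔ Criterion B
certified⇒balanced⇔criterion B e with criterionᵇ B in c
... | true  = mk⇔ (λ _ → Equivalence.to (criterionᵇ-reflects B) c) (λ _ → balancedCertificate-sound B e)
... | false = mk⇔ (λ bal → ⊥-elim (unbalancedCertificate-sound B e bal))
                  (λ crit → ⊥-elim (false≢true (trans (sym c) (Equivalence.from (criterionᵇ-reflects B) crit))))

fromTable : Bool → Bool → Bool → Bool → Bool → Bool → Pattern → Bool
fromTable b₁ b₂ b₃ b₄ b₅ b₆ p123 = b₁
fromTable b₁ b₂ b₃ b₄ b₅ b₆ p132 = b₂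
fromTable b₁ b₂ b₃ b₄ b₅ b₆ p213 = b₃
fromTable b₁ b₂ b₃ b₄ b₅ b₆ p231 = b₄
fromTable b₁ b₂ b₃ b₄ b₅ b₆ p312 = b₅
fromTable b₁ b₂ b₃ b₄ b₅ b₆ p321 = b₆

BoolFunction : ℕ → Set
BoolFunction zero    = Bool
BoolFunction (suc n) = Bool → BoolFunction n

allTrue : ∀ n → BoolFunction n → Bool
allTrue zero    b = b
allTrue (suc n) f = allTrue n (f true) ∧ allTrue n (f false)

AlwaysTrue : ∀ n → BoolFunction n → Set
AlwaysTrue zero    b = b ≡ true
AlwaysTrue (suc n) f = ∀ b → AlwaysTrue n (f b)

allTrue-sound : ∀ n f → allTrue n f ≡ true → AlwaysTrue n f
allTrue-sound zero    b e       = e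
allTrue-sound (suc n) f e true  = allTrue-sound n (f true) (proj₁ (∧-true⁻ e))
allTrue-sound (suc n) f e false = allTrue-sound n (f false) (proj₂ (∧-true⁻ {allTrue n (f true)} e))

all-certified : ∀ b₁ b₂ b₃ b₄ b₅ b₆ → certified (fromTable b₁ b₂ b₃ b₄ b₅ b₆) ≡ true
all-certified = allTrue-sound 6 (λ b₁ b₂ b₃ b₄ b₅ b₆ → certified (fromTable b₁ b₂ b₃ b₄ b₅ b₆)) refl

module _ {B B′ : Pattern → Bool} (B≗B′ : ∀ ρ → B ρ ≡ B′ ρ) where

  avoids-cong : ∀ l → avoids B l ≡ avoids B′ l
  avoids-cong l = all-cong _ _ (choose 3 l) (λ t _ → cong not (forbidden-cong (patternOf t)))
    where
    forbidden-cong : ∀ m → maybe′ B false m ≡ maybe′ B′ false m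
    forbidden-cong nothing  = refl
    forbidden-cong (just ρ) = B≗B′ ρ

  countAv-cong : ∀ p n → countAv B p n ≡ countAv B′ p n
  countAv-cong p n = count-cong _ _ (allLists n n) (λ l _ → cong (λ a → (distinct l ∧ a) ∧ p l) (avoids-cong l))

  AlwaysBalanced-cong : AlwaysBalanced B ⇔ AlwaysBalanced B′
  AlwaysBalanced-cong = mk⇔
    (λ bal n 1<n → trans (sym (countAv-cong isEven n)) (trans (bal n 1<n) (countAv-cong isOdd n)))
    (λ bal n 1<n → trans (countAv-cong isEven n) (trans (bal n 1<n) (sym (countAv-cong isOdd n))))

  countPatterns-cong : ∀ p → countPatterns B p ≡ countPatterns B′ p
  countPatterns-cong p = count-cong _ _ patterns (λ ρ _ → cong (_∧ p (oneLine ρ)) (B≗B′ ρ))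

  Criterion-cong : Criterion B ⇔ Criterion B′
  Criterion-cong = mk⇔
    (λ (notSpecial , parity) →
       (λ isSpecial → notSpecial (λ ρ → trans (B≗B′ ρ) (isSpecial ρ)))
       , trans (sym (countPatterns-cong isEven)) (trans parity (countPatterns-cong isOdd)))
    (λ (notSpecial , parity) →
       (λ isSpecial → notSpecial (λ ρ → trans (sym (B≗B′ ρ)) (isSpecial ρ)))
       , trans (countPatterns-cong isEven) (trans parity (sym (countPatterns-cong isOdd))))

balanced⇔criterion : ∀ B → AlwaysBalanced B ⇔ Criterion B
balanced⇔criterion B =
  ⇔-sym (Criterion-cong B≗table)
  ⇔-∘ (certified⇒balanced⇔criterion table (all-certified (B p123) (B p132) (B p213) (B p231) (B p312) (B p321))
  ⇔-∘ AlwaysBalanced-cong B≗table)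
  where
  table = fromTable (B p123) (B p132) (B p213) (B p231) (B p312) (B p321)
  B≗table : ∀ ρ → B ρ ≡ table ρ
  B≗table p123 = refl
  B≗table p132 = refl
  B≗table p213 = refl
  B≗table p231 = refl
  B≗table p312 = refl
  B≗table p321 = refl

count-oneLine : ∀ ρ (q : List ℕ → Bool) →
  count (λ ρ′ → does (≡-dec _≟_ (oneLine ρ′) (oneLine ρ)) ∧ q (oneLine ρ′)) patterns ≡ (if q (oneLine ρ) then 1 else 0)
count-oneLine p123 q = +-identityʳ _
count-oneLine p132 q = +-identityʳ _
count-oneLine p213 q = +-identityʳ _
count-oneLine p231 q = +-identityʳ _
count-oneLine p312 q = +-identityʳ _
count-oneLine p321 q = +-identityʳ _

count-patternSet : ∀ (p : List ℕ → Bool) pats → All (_∈ S 3) pats → Unique pats →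
  count p pats ≡ countPatterns (patternSet pats) p
count-patternSet p []       _                   _                  = sym (count-none _ patterns (λ _ _ → refl))
count-patternSet p (x ∷ xs) (x∈S3 ∷ xs⊆S3) (x∉xs ∷ unique) with S3≡oneLine x∈S3
... | ρ , refl = sym (begin
  countPatterns (patternSet (oneLine ρ ∷ xs)) p
    ≡⟨ count-cong _ _ patterns (λ ρ′ _ → ∧-distribʳ-∨ (p (oneLine ρ′)) (is ρ′) (patternSet xs ρ′)) ⟩
  count (λ ρ′ → (is ρ′ ∧ p (oneLine ρ′)) ∨ (patternSet xs ρ′ ∧ p (oneLine ρ′))) patterns
    ≡⟨ count-∨ (λ ρ′ → is ρ′ ∧ p (oneLine ρ′)) (λ ρ′ → patternSet xs ρ′ ∧ p (oneLine ρ′)) patterns disjoint ⟩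
  count (λ ρ′ → is ρ′ ∧ p (oneLine ρ′)) patterns + countPatterns (patternSet xs) p
    ≡⟨ cong₂ _+_ (count-oneLine ρ p) (sym (count-patternSet p xs xs⊆S3 unique)) ⟩
  count p (oneLine ρ ∷ xs) ∎)
  where
  open ≡-Reasoning
  is = λ ρ′ → does (≡-dec _≟_ (oneLine ρ′) (oneLine ρ))
  disjoint : ∀ ρ′ → ρ′ ∈ patterns → (is ρ′ ∧ p (oneLine ρ′)) ∧ (patternSet xs ρ′ ∧ p (oneLine ρ′)) ≡ false
  disjoint ρ′ _ with ≡-dec _≟_ (oneLine ρ′) (oneLine ρ) | oneLine ρ′ ∈ᴸ? xs
  ... | no _       | _          = refl
  ... | yes _      | no _       = ∧-zeroʳ _
  ... | yes same   | yes in-xs  = ⊥-elim (All.lookup x∉xs (subst (_∈ xs) same in-xs) refl)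

does-⇔ : ∀ {A B : Set} (a? : Dec A) (b? : Dec B) → A ⇔ B → does a? ≡ does b?
does-⇔ (yes a) (yes b) _   = refl
does-⇔ (no ¬a) (no ¬b) _   = refl
does-⇔ (yes a) (no ¬b) a⇔b = ⊥-elim (¬b (Equivalence.to a⇔b a))
does-⇔ (no ¬a) (yes b) a⇔b = ⊥-elim (¬a (Equivalence.from a⇔b b))

does-≡⇒⇔ : ∀ {A B : Set} (a? : Dec A) (b? : Dec B) → does a? ≡ does b? → A ⇔ B
does-≡⇒⇔ (yes a) (yes b) _  = mk⇔ (λ _ → b) (λ _ → a)
does-≡⇒⇔ (no ¬a) (no ¬b) _  = mk⇔ (λ a → ⊥-elim (¬a a)) (λ b → ⊥-elim (¬b b))
does-≡⇒⇔ (yes a) (no ¬b) ()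
does-≡⇒⇔ (no ¬a) (yes b) ()

specialSet≡does : ∀ ρ → specialSet ρ ≡ does (oneLine ρ ∈ᴸ? special)
specialSet≡does p123 = refl
specialSet≡does p132 = refl
specialSet≡does p213 = refl
specialSet≡does p231 = refl
specialSet≡does p312 = refl
specialSet≡does p321 = refl

special⊆S3 : ∀ {σ} → σ ∈ special → σ ∈ S 3
special⊆S3 (here refl)                         = there (here refl)
special⊆S3 (there (here refl))                 = there (there (here refl))
special⊆S3 (there (there (here refl)))         = there (there (there (here refl)))
special⊆S3 (there (there (there (here refl)))) = there (there (there (there (here refl))))

sameSet⇔ : ∀ pats → All (_∈ S 3) pats →
  (∀ σ → σ ∈ pats ⇔ σ ∈ special) ⇔ (∀ ρ → patternSet pats ρ ≡ specialSet ρ)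
sameSet⇔ pats pats⊆S3 = mk⇔
  (λ same ρ → trans (does-⇔ (oneLine ρ ∈ᴸ? pats) (oneLine ρ ∈ᴸ? special) (same (oneLine ρ)))
                    (sym (specialSet≡does ρ)))
  (λ same σ → mk⇔ (λ σ∈pats → Equivalence.to (viaPattern same (All.lookup pats⊆S3 σ∈pats)) σ∈pats)
                  (λ σ∈special → Equivalence.from (viaPattern same (special⊆S3 σ∈special)) σ∈special))
  where
  viaPattern : (∀ ρ → patternSet pats ρ ≡ specialSet ρ) → ∀ {σ} → σ ∈ S 3 → σ ∈ pats ⇔ σ ∈ special
  viaPattern same σ∈S3 with S3≡oneLine σ∈S3
  ... | ρ , refl = does-≡⇒⇔ (oneLine ρ ∈ᴸ? pats) (oneLine ρ ∈ᴸ? special) (trans (same ρ) (specialSet≡does ρ))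

alwaysSignBalanced⇔ : ∀ pats → All (_∈ S 3) pats →
  (∀ n → 1 < n → SignBalanced (Av n pats)) ⇔ AlwaysBalanced (patternSet pats)
alwaysSignBalanced⇔ pats pats⊆S3 = mk⇔
  (λ bal n 1<n → trans (sym (count-Av pats pats⊆S3 isEven n)) (trans (bal n 1<n) (count-Av pats pats⊆S3 isOdd n)))
  (λ bal n 1<n → trans (count-Av pats pats⊆S3 isEven n) (trans (bal n 1<n) (sym (count-Av pats pats⊆S3 isOdd n))))

criterion⇔ : ∀ pats → All (_∈ S 3) pats → Unique pats →
  Criterion (patternSet pats) ⇔ ((¬ (∀ σ → σ ∈ pats ⇔ σ ∈ special)) × SignBalanced pats)
criterion⇔ pats pats⊆S3 unique = mk⇔
  (λ (notSpecial , parity) →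
     (λ same → notSpecial (Equivalence.to (sameSet⇔ pats pats⊆S3) same))
     , trans (count-patternSet isEven pats pats⊆S3 unique)
             (trans parity (sym (count-patternSet isOdd pats pats⊆S3 unique))))
  (λ (notSame , balanced) →
     (λ isSpecial → notSame (Equivalence.from (sameSet⇔ pats pats⊆S3) isSpecial))
     , trans (sym (count-patternSet isEven pats pats⊆S3 unique))
             (trans balanced (count-patternSet isOdd pats pats⊆S3 unique)))

theorem1p2 : (pats : List (List ℕ)) → All (λ σ → σ ∈ S 3) pats → Unique pats →
    ((∀ (n : ℕ) → 1 < n → SignBalanced (Av n pats))
      ⇔ ((¬ (∀ (σ : List ℕ) → (σ ∈ pats) ⇔ (σ ∈ special))) × SignBalanced pats))
theorem1p2 pats pats⊆S3 unique =
  criterion⇔ pats pats⊆S3 unique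
  ⇔-∘ (balanced⇔criterion (patternSet pats)
  ⇔-∘ alwaysSignBalanced⇔ pats pats⊆S3)
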